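{- For $n\ge2$, the number of Boolean functions $f:\mathbb{F}_2^n\to\mathbb{F}_2$ that are both monotone and nested canalyzing equals $$4\sum_{\substack{r\ge1,\ k_1+\dots+k_r=n\\ k_i\ge1\ (i=1,\dots,r-1),\ k_r\ge2}}\frac{n!}{k_1!\,k_2!\cdots k_r!}.$$
   Context: $\overline{a}=a\oplus1$ over $\mathbb{F}_2$. A Boolean function $f:\mathbb{F}_2^n\to\mathbb{F}_2$ is nested canalyzing if there exist a permutation $\sigma$ of $\{1,\dots,n\}$ and $a_1,\dots,a_n,b_1,\dots,b_n\in\mathbb{F}_2$ such that $f=b_1$ when $x_{\sigma(1)}=a_1$; $f=b_k$ when $x_{\sigma(j)}=\overline{a_j}$ for $j<k$ and $x_{\sigma(k)}=a_k$ ($k=2,\dots,n$); and $f=\overline{b_n}$ when $x_{\sigma(j)}=\overline{a_j}$ for all $j$. $f$ is monotone if it is monotone increasing or monotone decreasing with respect to the componentwise order on $\mathbb{F}_2^n$ (with $0<1$). The sum ranges over all $r\ge1$ and all ordered tuples $(k_1,\dots,k_r)$ of integers satisfying the stated conditions. -}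

module Defs where

open import Data.Bool using (Bool; true; false; not; _∧_; if_then_else_)
  renaming (_≤_ to _≤ᵇ_)
open import Data.Nat using (ℕ; zero; suc; _+_; _*_; _<_; _!; _≡ᵇ_; NonZero)
  renaming (_≤ᵇ_ to _≤ℕᵇ_)
open import Data.Nat.DivMod using (_/_)
open import Data.Nat.Properties using (_!≢0; m*n≢0)
open import Data.Fin using (Fin; fromℕ) renaming (_<_ to _<ᶠ_)
open import Data.Fin.Permutation using (Permutation′; _⟨$⟩ʳ_)
open import Data.List using (List; []; _∷_; map; concatMap; upTo; filterᵇ)
open import Data.Nat.ListAction using (sum; product)
open import Data.Product using (Σ; ∃; _×_; _,_)
open import Data.Sum using (_⊎_)
open import Relation.Binary.PropositionalEquality using (_≡_)

BF : ℕ → Set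
BF n = (Fin n → Bool) → Bool

_≼_ : ∀ {n} → (Fin n → Bool) → (Fin n → Bool) → Set
x ≼ y = ∀ i → x i ≤ᵇ y i

MonotoneIncreasing : ∀ {n} → BF n → Set
MonotoneIncreasing f = ∀ x y → x ≼ y → f x ≤ᵇ f y

MonotoneDecreasing : ∀ {n} → BF n → Set
MonotoneDecreasing f = ∀ x y → x ≼ y → f y ≤ᵇ f x

Monotone : ∀ {n} → BF n → Set
Monotone f = MonotoneIncreasing f ⊎ MonotoneDecreasing f

-- Nested canalyzing (defined for n ≥ 1, i.e. n = suc m; the last index is fromℕ m),
-- exactly as in the paper: permutation σ, canalyzing inputs a, canalyzed outputs b.
NestedCanalyzingWith : ∀ {m} → BF (suc m) → Permutation′ (suc m)
  → (Fin (suc m) → Bool) → (Fin (suc m) → Bool) → Set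
NestedCanalyzingWith {m} f σ a b =
  (∀ x (k : Fin (suc m))
     → (∀ j → j <ᶠ k → x (σ ⟨$⟩ʳ j) ≡ not (a j))
     → x (σ ⟨$⟩ʳ k) ≡ a k
     → f x ≡ b k)
  × (∀ x → (∀ j → x (σ ⟨$⟩ʳ j) ≡ not (a j)) → f x ≡ not (b (fromℕ m)))

NestedCanalyzing : ∀ {m} → BF (suc m) → Set
NestedCanalyzing f = ∃ λ σ → ∃ λ a → ∃ λ b → NestedCanalyzingWith f σ a b

_≐_ : ∀ {n} → BF n → BF n → Set
f ≐ g = ∀ x → f x ≡ g x

tuples : ℕ → ℕ → List (List ℕ)
tuples zero    n = [] ∷ []
tuples (suc r) n = concatMap (λ k → map (k ∷_) (tuples r n)) (map suc (upTo n))

lastAtLeast2 : List ℕ → Bool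
lastAtLeast2 []           = false
lastAtLeast2 (k ∷ [])     = 2 ≤ℕᵇ k
lastAtLeast2 (_ ∷ k ∷ ks) = lastAtLeast2 (k ∷ ks)

admissible : ℕ → List ℕ → Bool
admissible n ks = (sum ks ≡ᵇ n) ∧ lastAtLeast2 ks

prodFact-nonZero : (ks : List ℕ) → NonZero (product (map _! ks))
prodFact-nonZero []       = _
prodFact-nonZero (k ∷ ks) = m*n≢0 (k !) (product (map _! ks))
  {{k !≢0}} {{prodFact-nonZero ks}}

multinomial : ℕ → List ℕ → ℕ
multinomial n ks = (n ! / product (map _! ks)) {{prodFact-nonZero ks}}

-- Σ over r ∈ {1,…,n} and admissible r-tuples (each kᵢ ≥ 1 forces r ≤ n)
compositionSum : ℕ → ℕ
compositionSum n =
  sum (concatMap (λ r → map (multinomial n) (filterᵇ (admissible n) (tuples r n)))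
                 (map suc (upTo n)))

module Submission where

-- A monotone increasing NCF is a "layered" function: the variables
-- are partitioned into layers 0,…,R-1 by a map code, a starting value c is
-- fixed, and f x = alt c l where l is the first layer containing a
-- variable x i equal to alt c l (alt c l alternates with l, starting at c);
-- if there is none, f x = alt c R.  Conversely every such layered function
-- is monotone increasing and nested canalyzing.  The representation is
-- unique once it is canonical: code is onto {0,…,R-1} and its last layer
-- has at least two variables.  Canonical codes with layer sizes (k₁,…,k_R)
-- are counted by the multinomial coefficient n!/(k₁!⋯k_R!), and the sizes
-- range over the admissible tuples of the statement.  Decreasing functions
-- are the increasing ones precomposed with negation, and together with the
-- choice of c this gives the factor 4.

open import Defs
open import Data.Nat using (ℕ; suc; _*_; _≤_)
open import Data.List using (List; length)
open import Data.List.Membership.Propositional using (_∈_)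
open import Data.List.Relation.Unary.All using (All)
open import Data.List.Relation.Unary.AllPairs using (AllPairs)
open import Data.Product using (Σ; ∃; _×_)
open import Relation.Nullary using (¬_)
open import Relation.Binary.PropositionalEquality using (_≡_)

open import Data.Nat
open import Data.Nat.Properties
open import Data.Nat.ListAction using (sum; product)
open import Data.Nat.ListAction.Properties using (sum-++)
open import Data.Nat.Combinatorics
  using (_C_; nCk≡n!/k![n-k]!; k![n∸k]!∣n!; nCk+nC[k+1]≡[n+1]C[k+1])
open import Data.Nat.DivMod using (_/_; m/n*n≡m; m*n/n≡m)
open import Data.Bool using (Bool; true; false; not; T; if_then_else_; _∨_)
  renaming (_≤_ to _≤ᴮ_)
open import Data.Bool.Base using (f≤t; b≤b)
open import Data.Bool.Properties using (not-involutive; T-∧)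
open import Data.Unit using (⊤; tt)
open import Data.Empty using (⊥; ⊥-elim)
open import Data.Sum using (_⊎_; inj₁; inj₂)
open import Data.Product using (_,_; proj₁; proj₂)
open import Data.Fin using (Fin; zero; suc; toℕ; fromℕ; fromℕ<; punchIn)
  renaming (_<_ to _<ᶠ_; _≟_ to _≟ᶠ_)
open import Data.Fin.Properties
  using (any?; toℕ<n; toℕ≤pred[n]; toℕ-fromℕ; toℕ-fromℕ<; toℕ-injective)
open import Data.Fin.Permutation
  using (Permutation′; _⟨$⟩ʳ_; _⟨$⟩ˡ_; inverseʳ; inverseˡ; insert; insert-punchIn; id)
open import Data.List
  using ([]; _∷_; _++_; map; concatMap; upTo; tabulate; filterᵇ)
open import Data.List.Properties using (length-map; length-++; length-tabulate)
open import Data.List.Relation.Unary.All as All using ([]; _∷_)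
import Data.List.Relation.Unary.All.Properties as AllP
open import Data.List.Relation.Unary.Any using (here; there)
open import Data.List.Relation.Unary.AllPairs using ([]; _∷_)
import Data.List.Relation.Unary.AllPairs.Properties as AllPairsP
open import Data.List.Relation.Unary.Unique.Propositional using (Unique)
open import Data.List.Relation.Unary.Unique.Propositional.Properties using (upTo⁺)
open import Data.List.Membership.Propositional using (find; lose)
open import Data.List.Membership.Propositional.Properties
  using (∈-map⁺; ∈-map⁻; ∈-++⁺ˡ; ∈-++⁺ʳ; ∈-++⁻; ∈-concatMap⁺; ∈-concatMap⁻;
         ∈-upTo⁺; ∈-filter⁺; ∈-filter⁻)
open import Relation.Binary.PropositionalEquality
  using (_≢_; refl; sym; trans; cong; cong₂; subst; subst₂; module ≡-Reasoning)
open import Relation.Binary.Definitions using (tri<; tri≈; tri>)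
open import Relation.Nullary using (yes; no; Dec)
open import Relation.Nullary.Decidable using (T?; ¬?; _×-dec_)
open import Function using (_∘_)
open import Function.Bundles using (Equivalence)

∈-concatMap⁺′ : {A B : Set} (f : A → List B) {x : A} {y : B} {xs : List A} →
  x ∈ xs → y ∈ f x → y ∈ concatMap f xs
∈-concatMap⁺′ f {y = y} x∈ y∈ = ∈-concatMap⁺ f (lose {P = λ x → y ∈ f x} x∈ y∈)

∈-concatMap⁻′ : {A B : Set} (f : A → List B) {y : B} {xs : List A} →
  y ∈ concatMap f xs → ∃ λ x → x ∈ xs × y ∈ f x
∈-concatMap⁻′ f y∈ = find (∈-concatMap⁻ f y∈)

unique⇒AllPairs : {A : Set} (Rel : A → A → Set) (xs : List A) → Unique xs →
  (∀ {x y} → x ∈ xs → y ∈ xs → Rel x y → x ≡ y) → AllPairs (λ x y → ¬ Rel x y) xs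
unique⇒AllPairs Rel []       []          _   = []
unique⇒AllPairs Rel (x ∷ xs) (x∉ ∷ uniq) inj =
  All.tabulate (λ y∈ r → All.lookup x∉ y∈ (inj (here refl) (there y∈) r))
  ∷ unique⇒AllPairs Rel xs uniq (λ p q → inj (there p) (there q))

map-unique : {A B : Set} (f : A → B) (xs : List A) → Unique xs →
  (∀ {x y} → x ∈ xs → y ∈ xs → f x ≡ f y → x ≡ y) → Unique (map f xs)
map-unique f xs uniq inj = AllPairsP.map⁺ (unique⇒AllPairs (λ x y → f x ≡ f y) xs uniq inj)

concatMap-unique : {A B : Set} (key : B → A) (f : A → List B) (xs : List A) →
  Unique xs → (∀ {x y} → x ∈ xs → y ∈ f x → key y ≡ x) →
  (∀ {x} → x ∈ xs → Unique (f x)) → Unique (concatMap f xs)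
concatMap-unique key f []       _           _      _     = []
concatMap-unique key f (x ∷ xs) (x∉ ∷ uniq) keyed blocks =
  AllPairsP.++⁺ (blocks (here refl))
    (concatMap-unique key f xs uniq (keyed ∘ there) (blocks ∘ there))
    (All.tabulate λ y∈ → All.tabulate λ y′∈ y≡y′ →
      let (z , z∈ , y′∈z) = ∈-concatMap⁻′ f y′∈
      in All.lookup x∉ z∈ (trans (sym (keyed (here refl) y∈))
                            (trans (cong key y≡y′) (keyed (there z∈) y′∈z))))

length-concatMap : {A B : Set} (f : A → List B) (h : A → ℕ) (k : ℕ) (xs : List A) →
  (∀ {x} → x ∈ xs → length (f x) ≡ k * h x) →
  length (concatMap f xs) ≡ k * sum (map h xs)
length-concatMap f h k []       _   = sym (*-zeroʳ k)
length-concatMap f h k (x ∷ xs) len = begin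
  length (f x ++ concatMap f xs)          ≡⟨ length-++ (f x) ⟩
  length (f x) + length (concatMap f xs)  ≡⟨ cong₂ _+_ (len (here refl))
                                               (length-concatMap f h k xs (len ∘ there)) ⟩
  k * h x + k * sum (map h xs)            ≡⟨ *-distribˡ-+ k (h x) _ ⟨
  k * (h x + sum (map h xs))              ∎
  where open ≡-Reasoning

length-concatMap-const : {A B : Set} (f : A → List B) (c : ℕ) (xs : List A) →
  (∀ {x} → x ∈ xs → length (f x) ≡ c) → length (concatMap f xs) ≡ length xs * c
length-concatMap-const f c []       _   = refl
length-concatMap-const f c (x ∷ xs) len = trans (length-++ (f x))
  (cong₂ _+_ (len (here refl)) (length-concatMap-const f c xs (len ∘ there)))

sum-concatMap : {A : Set} (g : A → List ℕ) (xs : List A) →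
  sum (concatMap g xs) ≡ sum (map (sum ∘ g) xs)
sum-concatMap g []       = refl
sum-concatMap g (x ∷ xs) = trans (sum-++ (g x) (concatMap g xs)) (cong (sum (g x) +_) (sum-concatMap g xs))

-- nth element of a list of naturals, 0 when out of range.
nth : List ℕ → ℕ → ℕ
nth []       j       = 0
nth (x ∷ xs) zero    = x
nth (x ∷ xs) (suc j) = nth xs j

All-nth : {P : ℕ → Set} {xs : List ℕ} → All P xs → ∀ j → j < length xs → P (nth xs j)
All-nth (p ∷ _)  zero    _       = p
All-nth (_ ∷ ps) (suc j) (s≤s lt) = All-nth ps j lt

nth-ext : ∀ xs ys → length xs ≡ length ys → (∀ j → j < length xs → nth xs j ≡ nth ys j) → xs ≡ ys
nth-ext []       []       _   _  = refl
nth-ext (x ∷ xs) (y ∷ ys) len eq =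
  cong₂ _∷_ (eq 0 (s≤s z≤n)) (nth-ext xs ys (suc-injective len) (λ j lt → eq (suc j) (s≤s lt)))

nth-tabulate : ∀ {n} (g : Fin n → ℕ) i → nth (tabulate g) (toℕ i) ≡ g i
nth-tabulate g zero    = refl
nth-tabulate g (suc i) = nth-tabulate (g ∘ suc) i

b≢not-b : ∀ {b} → b ≢ not b
b≢not-b {true}  ()
b≢not-b {false} ()

bool-cases : ∀ b e → b ≡ e ⊎ b ≡ not e
bool-cases true  true  = inj₁ refl
bool-cases true  false = inj₂ refl
bool-cases false true  = inj₂ refl
bool-cases false false = inj₁ refl

sameᵇ : Bool → Bool → Bool
sameᵇ true  b = b
sameᵇ false b = not b

sameᵇ-true : ∀ {a b} → sameᵇ a b ≡ true → a ≡ b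
sameᵇ-true {true}  {true}  _ = refl
sameᵇ-true {false} {false} _ = refl

sameᵇ-false : ∀ {a b} → sameᵇ a b ≡ false → a ≡ not b
sameᵇ-false {true}  {false} _ = refl
sameᵇ-false {false} {true}  _ = refl

true⇒T : ∀ {b} → b ≡ true → T b
true⇒T refl = tt

T⇒true : ∀ {b} → T b → b ≡ true
T⇒true {true} _ = refl

≤ᴮ-intro : ∀ {a b} → (a ≡ true → b ≡ true) → a ≤ᴮ b
≤ᴮ-intro {false} {false} _ = b≤b
≤ᴮ-intro {false} {true}  _ = f≤t
≤ᴮ-intro {true}  {true}  _ = b≤b
≤ᴮ-intro {true}  {false} h with h refl
... | ()

≤ᴮ-true : ∀ {a b} → a ≤ᴮ b → a ≡ true → b ≡ true
≤ᴮ-true b≤b e = e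

≤ᴮ-false : ∀ {a b} → a ≤ᴮ b → b ≡ false → a ≡ false
≤ᴮ-false b≤b e = e

not-antitone : ∀ {a b} → a ≤ᴮ b → not b ≤ᴮ not a
not-antitone f≤t = f≤t
not-antitone b≤b = b≤b

negate-increasing : ∀ {n} (f : BF n) → MonotoneIncreasing f → MonotoneDecreasing (f ∘ (not ∘_))
negate-increasing f inc x y x≼y = inc (not ∘ y) (not ∘ x) (not-antitone ∘ x≼y)

negate-decreasing : ∀ {n} (f : BF n) → MonotoneDecreasing f → MonotoneIncreasing (f ∘ (not ∘_))
negate-decreasing f dec x y x≼y = dec (not ∘ y) (not ∘ x) (not-antitone ∘ x≼y)

-- The value attached to layer l when layer 0 has value c: c, not c, c, …
alt : Bool → ℕ → Bool
alt c zero    = c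
alt c (suc l) = not (alt c l)

alt-twice : ∀ c l → alt c (suc (suc l)) ≡ alt c l
alt-twice c l = not-involutive (alt c l)

alt-injective : ∀ c c′ l → alt c l ≡ alt c′ l → c ≡ c′
alt-injective c c′ zero    e = e
alt-injective c c′ (suc l) e =
  alt-injective c c′ l (trans (sym (not-involutive _)) (trans (cong not e) (not-involutive _)))

minOver : ∀ {n} → (Fin n → ℕ) → ℕ → ℕ
minOver {zero}  g d = d
minOver {suc n} g d = g zero ⊓ minOver (g ∘ suc) d

minOver-≤ : ∀ {n} (g : Fin n → ℕ) d i → minOver g d ≤ g i
minOver-≤ g d zero    = m⊓n≤m _ _
minOver-≤ g d (suc i) = ≤-trans (m⊓n≤n _ _) (minOver-≤ (g ∘ suc) d i)

minOver-≤-default : ∀ {n} (g : Fin n → ℕ) d → minOver g d ≤ d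
minOver-≤-default {zero}  g d = ≤-refl
minOver-≤-default {suc n} g d = ≤-trans (m⊓n≤n _ _) (minOver-≤-default (g ∘ suc) d)

minOver-glb : ∀ {n} (g : Fin n → ℕ) d t → t ≤ d → (∀ i → t ≤ g i) → t ≤ minOver g d
minOver-glb {zero}  g d t t≤d _  = t≤d
minOver-glb {suc n} g d t t≤d lb = ⊓-glb (lb zero) (minOver-glb (g ∘ suc) d t t≤d (lb ∘ suc))

minOver-attained : ∀ {n} (g : Fin n → ℕ) d → minOver g d ≡ d ⊎ ∃ λ i → minOver g d ≡ g i
minOver-attained {zero}  g d = inj₁ refl
minOver-attained {suc n} g d with ⊓-sel (g zero) (minOver (g ∘ suc) d)
... | inj₁ e = inj₂ (zero , e)
... | inj₂ e with minOver-attained (g ∘ suc) d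
...   | inj₁ e′       = inj₁ (trans e e′)
...   | inj₂ (i , e′) = inj₂ (suc i , trans e e′)

minOver-cong : ∀ {n} (g h : Fin n → ℕ) d → (∀ i → g i ≡ h i) → minOver g d ≡ minOver h d
minOver-cong {zero}  g h d eq = refl
minOver-cong {suc n} g h d eq = cong₂ _⊓_ (eq zero) (minOver-cong (g ∘ suc) (h ∘ suc) d (eq ∘ suc))

-- Layered functions.  code i is the layer of variable i and R the number
-- of layers.  Variable i "hits" when x i = alt c (code i); the value is
-- alt c of the first layer containing a hit (R if there is none).
hitLayer : ∀ {n} → Bool → ℕ → (Fin n → ℕ) → (Fin n → Bool) → Fin n → ℕ
hitLayer c R code x i = if sameᵇ (x i) (alt c (code i)) then code i else R

firstHit : ∀ {n} → Bool → ℕ → (Fin n → ℕ) → (Fin n → Bool) → ℕ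
firstHit c R code x = minOver (hitLayer c R code x) R

layered : ∀ {n} → Bool → ℕ → (Fin n → ℕ) → BF n
layered c R code x = alt c (firstHit c R code x)

Canonical : ∀ {n} → (Fin n → ℕ) → ℕ → Set
Canonical code R = (∀ i → code i < R)
                 × (∀ l → l < R → ∃ λ i → code i ≡ l)
                 × (∀ i → ¬ (∀ k → code k ≡ pred R → k ≡ i))

module _ {n} (c : Bool) (R : ℕ) (code : Fin n → ℕ) (x : Fin n → Bool) where

  hitLayer-hit : ∀ i → x i ≡ alt c (code i) → hitLayer c R code x i ≡ code i
  hitLayer-hit i e with x i | alt c (code i)
  hitLayer-hit i refl | true  | true  = refl
  hitLayer-hit i refl | false | false = refl

  hitLayer-cases : ∀ i → (x i ≡ alt c (code i) × hitLayer c R code x i ≡ code i)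
                       ⊎ (x i ≡ not (alt c (code i)) × hitLayer c R code x i ≡ R)
  hitLayer-cases i with x i | alt c (code i)
  ... | true  | true  = inj₁ (refl , refl)
  ... | false | false = inj₁ (refl , refl)
  ... | true  | false = inj₂ (refl , refl)
  ... | false | true  = inj₂ (refl , refl)

  firstHit-is : ∀ t → t ≤ R → (∀ i → code i < t → x i ≡ not (alt c (code i))) →
    (t ≡ R ⊎ ∃ λ i → code i ≡ t × x i ≡ alt c t) → firstHit c R code x ≡ t
  firstHit-is t t≤R below attained = ≤-antisym (upper attained) lower
    where
    lower : t ≤ firstHit c R code x
    lower = minOver-glb _ R t t≤R bound
      where
      bound : ∀ i → t ≤ hitLayer c R code x i
      bound i with hitLayer-cases i
      ... | inj₂ (_ , e) = subst (t ≤_) (sym e) t≤R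
      ... | inj₁ (hit , e) with t ≤? code i
      ...   | yes t≤ = subst (t ≤_) (sym e) t≤
      ...   | no  t≰ = ⊥-elim (b≢not-b (trans (sym hit) (below i (≰⇒> t≰))))
    upper : (t ≡ R ⊎ ∃ λ i → code i ≡ t × x i ≡ alt c t) → firstHit c R code x ≤ t
    upper (inj₁ refl)          = minOver-≤-default (hitLayer c R code x) R
    upper (inj₂ (i , ci , xi)) = ≤-trans (minOver-≤ _ R i)
      (≤-reflexive (trans (hitLayer-hit i (trans xi (cong (alt c) (sym ci)))) ci))

  firstHit-witness : firstHit c R code x < R →
    ∃ λ i → x i ≡ alt c (code i) × code i ≡ firstHit c R code x
  firstHit-witness lt with minOver-attained (hitLayer c R code x) R
  ... | inj₁ e = ⊥-elim (<-irrefl e lt)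
  ... | inj₂ (i , e) with hitLayer-cases i
  ...   | inj₁ (hit , e′) = i , hit , sym (trans e e′)
  ...   | inj₂ (_ , e′)   = ⊥-elim (<-irrefl (trans e e′) lt)

  firstHit-≤ : ∀ i → x i ≡ alt c (code i) → firstHit c R code x ≤ code i
  firstHit-≤ i hit = ≤-trans (minOver-≤ _ R i) (≤-reflexive (hitLayer-hit i hit))

layered-value : ∀ {n} c R (code : Fin n → ℕ) x t → t ≤ R →
  (∀ i → code i < t → x i ≡ not (alt c (code i))) →
  (t ≡ R ⊎ ∃ λ i → code i ≡ t × x i ≡ alt c t) → layered c R code x ≡ alt c t
layered-value c R code x t t≤R below attained = cong (alt c) (firstHit-is c R code x t t≤R below attained)

layered-cong : ∀ {n} c R (code code′ : Fin n → ℕ) x → (∀ i → code i ≡ code′ i) →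
  layered c R code x ≡ layered c R code′ x
layered-cong c R code code′ x eq = cong (alt c) (minOver-cong _ _ R λ i →
  cong (λ l → if sameᵇ (x i) (alt c l) then l else R) (eq i))

layered-ext : ∀ {n} c R (code : Fin n → ℕ) x y → (∀ i → x i ≡ y i) →
  layered c R code x ≡ layered c R code y
layered-ext c R code x y eq = cong (alt c) (minOver-cong _ _ R λ i →
  cong (λ b → if sameᵇ b (alt c (code i)) then code i else R) (eq i))

-- Layered functions are monotone increasing: raising the input can only move
-- the first hit to a layer of value true (or keep a true one).
layered-increasing : ∀ {n} c R (code : Fin n → ℕ) → MonotoneIncreasing (layered c R code)
layered-increasing c R code x y x≼y = ≤ᴮ-intro stays-true
  where
  hx = firstHit c R code x
  hy = firstHit c R code y
  stays-true : alt c hx ≡ true → alt c hy ≡ true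
  stays-true vx with bool-cases (alt c hy) true
  ... | inj₁ vy = vy
  ... | inj₂ vy with <-cmp hx hy
  ...   | tri≈ _ eq _ = ⊥-elim (b≢not-b (trans (sym vx) (trans (cong (alt c) eq) vy)))
  ...   | tri< lt _ _ =
    let (i , xi , ci) = firstHit-witness c R code x (<-≤-trans lt (minOver-≤-default (hitLayer c R code y) R))
        yi = ≤ᴮ-true (x≼y i) (trans xi (trans (cong (alt c) ci) vx))
    in ⊥-elim (<⇒≱ lt (subst (hy ≤_) ci
         (firstHit-≤ c R code y i (trans yi (sym (trans (cong (alt c) ci) vx))))))
  ...   | tri> _ _ gt =
    let (i , yi , ci) = firstHit-witness c R code y (<-≤-trans gt (minOver-≤-default (hitLayer c R code x) R))
        xi = ≤ᴮ-false (x≼y i) (trans yi (trans (cong (alt c) ci) vy))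
    in ⊥-elim (<⇒≱ gt (subst (hx ≤_) ci
         (firstHit-≤ c R code x i (trans xi (sym (trans (cong (alt c) ci) vy))))))

argmin : ∀ {n} (g : Fin (suc n) → ℕ) → ∃ λ v → ∀ i → g v ≤ g i
argmin {zero}  g = zero , λ { zero → ≤-refl }
argmin {suc n} g with argmin (g ∘ suc)
... | v , min with g zero ≤? g (suc v)
...   | yes p = zero  , λ { zero → ≤-refl ; (suc i) → ≤-trans p (min i) }
...   | no ¬p = suc v , λ { zero → <⇒≤ (≰⇒> ¬p) ; (suc i) → min i }

sortPerm : ∀ {n} → (Fin n → ℕ) → Permutation′ n
sortPerm {zero}  g = id
sortPerm {suc n} g = insert zero (proj₁ (argmin g)) (sortPerm (g ∘ punchIn (proj₁ (argmin g))))

sortPerm-sorted : ∀ {n} (g : Fin n → ℕ) (p q : Fin n) → toℕ p ≤ toℕ q →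
  g (sortPerm g ⟨$⟩ʳ p) ≤ g (sortPerm g ⟨$⟩ʳ q)
sortPerm-sorted {suc n} g zero q _ = proj₂ (argmin g) _
sortPerm-sorted {suc n} g (suc p) (suc q) (s≤s le) =
  let v = proj₁ (argmin g) ; π = sortPerm (g ∘ punchIn v) in
  subst₂ (λ a b → g a ≤ g b) (sym (insert-punchIn zero v π p)) (sym (insert-punchIn zero v π q))
    (sortPerm-sorted (g ∘ punchIn v) p q le)

≤-last : ∀ {m} (j : Fin (suc m)) → toℕ j ≤ toℕ (fromℕ m)
≤-last {m} j = subst (toℕ j ≤_) (sym (toℕ-fromℕ m)) (toℕ≤pred[n] j)

<-last⇒≢ : ∀ {m} (j k : Fin (suc m)) → j <ᶠ k → j ≢ fromℕ m
<-last⇒≢ j k lt refl = <⇒≱ lt (≤-last k)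

<ᶠ⇒≢ : ∀ {n} {j k : Fin n} → j <ᶠ k → j ≢ k
<ᶠ⇒≢ lt refl = <-irrefl refl lt

-- A canonical layered function is nested canalyzing: read the variables in
-- increasing layer order; the canalyzing and canalyzed values of a variable
-- are both the value of its layer.
module LayeredNCF {m} (c : Bool) (R : ℕ) (code : Fin (suc m) → ℕ) (canon : Canonical code R) where

  σ : Permutation′ (suc m)
  σ = sortPerm code

  values : Fin (suc m) → Bool
  values k = alt c (code (σ ⟨$⟩ʳ k))

  sorted-order : ∀ j k → code (σ ⟨$⟩ʳ j) < code (σ ⟨$⟩ʳ k) → j <ᶠ k
  sorted-order j k lt with toℕ k ≤? toℕ j
  ... | yes le = ⊥-elim (<⇒≱ lt (sortPerm-sorted code k j le))
  ... | no ¬le = ≰⇒> ¬le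

  misses : ∀ (x : Fin (suc m) → Bool) i (P : Fin (suc m) → Set) → P (σ ⟨$⟩ˡ i) →
    (∀ j → P j → x (σ ⟨$⟩ʳ j) ≡ not (values j)) → x i ≡ not (alt c (code i))
  misses x i P p h = subst (λ z → x z ≡ not (alt c (code z))) (inverseʳ σ) (h (σ ⟨$⟩ˡ i) p)

  R>0 : 0 < R
  R>0 = ≤-<-trans z≤n (proj₁ canon zero)

  last-in-top-layer : code (σ ⟨$⟩ʳ fromℕ m) ≡ pred R
  last-in-top-layer = ≤-antisym (∸-monoˡ-≤ 1 (proj₁ canon _)) top≤
    where
    top = proj₁ (proj₂ canon) (pred R) (∸-monoʳ-< {R} {1} {0} (s≤s z≤n) R>0)
    top≤ : pred R ≤ code (σ ⟨$⟩ʳ fromℕ m)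
    top≤ = subst (_≤ code (σ ⟨$⟩ʳ fromℕ m)) (trans (cong code (inverseʳ σ)) (proj₂ top))
             (sortPerm-sorted code (σ ⟨$⟩ˡ proj₁ top) (fromℕ m) (≤-last _))

  nestedCanalyzing : NestedCanalyzingWith (layered c R code) σ values values
  nestedCanalyzing = canalyzed , default
    where
    canalyzed : ∀ x k → (∀ j → j <ᶠ k → x (σ ⟨$⟩ʳ j) ≡ not (values j)) →
      x (σ ⟨$⟩ʳ k) ≡ values k → layered c R code x ≡ values k
    canalyzed x k earlier xk = layered-value c R code x (code (σ ⟨$⟩ʳ k)) (<⇒≤ (proj₁ canon _))
      (λ i lt → misses x i (_<ᶠ k)
         (sorted-order (σ ⟨$⟩ˡ i) k (subst (λ z → code z < code (σ ⟨$⟩ʳ k)) (sym (inverseʳ σ)) lt))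
         earlier)
      (inj₂ (σ ⟨$⟩ʳ k , refl , xk))
    default : ∀ x → (∀ j → x (σ ⟨$⟩ʳ j) ≡ not (values j)) →
      layered c R code x ≡ not (values (fromℕ m))
    default x all = trans
      (layered-value c R code x R ≤-refl (λ i _ → misses x i (λ _ → ⊤) tt (λ j _ → all j)) (inj₁ refl))
      (cong (alt c) (sym (trans (cong suc last-in-top-layer) (suc-pred R {{>-nonZero R>0}}))))

negate-nestedCanalyzing : ∀ {m} (f : BF (suc m)) σ a b → NestedCanalyzingWith f σ a b →
  NestedCanalyzingWith (f ∘ (not ∘_)) σ (not ∘ a) b
negate-nestedCanalyzing f σ a b (canalyzed , default) =
  (λ x k earlier xk → canalyzed (not ∘ x) k
     (λ j lt → cong not (trans (earlier j lt) (not-involutive (a j))))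
     (trans (cong not xk) (not-involutive (a k)))) ,
  (λ x all → default (not ∘ x) (λ j → cong not (trans (all j) (not-involutive (a j)))))

window2 : ∀ {j l} → j ≤ l → l < 2 + j → l ≡ j ⊎ l ≡ suc j
window2 {j} {l} j≤l l<  with m≤n⇒m<n∨m≡n j≤l
... | inj₂ j≡l = inj₁ (sym j≡l)
... | inj₁ j<l = inj₂ (≤-antisym (≤-pred l<) j<l)

window3 : ∀ {j l} → j ≤ l → l < 3 + j → l ≡ j ⊎ l ≡ suc j ⊎ l ≡ suc (suc j)
window3 {j} {l} j≤l l< with m≤n⇒m<n∨m≡n j≤l
... | inj₂ j≡l = inj₁ (sym j≡l)
... | inj₁ j<l = inj₂ (window2 j<l l<)

alone-or-not : ∀ {n} (code : Fin n → ℕ) i l →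
  (∃ λ k → k ≢ i × code k ≡ l) ⊎ (∀ k → code k ≡ l → k ≡ i)
alone-or-not code i l with any? (λ k → ¬? (k ≟ᶠ i) ×-dec (code k ≟ l))
... | yes (k , k≢i , ck) = inj₁ (k , k≢i , ck)
... | no none = inj₂ λ k ck → decide k ck
  where
  decide : ∀ k → code k ≡ l → k ≡ i
  decide k ck with k ≟ᶠ i
  ... | yes k≡i = k≡i
  ... | no  k≢i = ⊥-elim (none (k , k≢i , ck))

-- Recovering the layer of a variable from the values of a canonical
-- layered function.  Fix a layer j and a variable i with j ≤ code i, and
-- probe the point x on which every variable below layer j misses, i takes
-- some value e and all other variables from layer j on take not e.  If the
-- function value at x is e, then code i = j and e is the value of layer j.
module Probe {n} (code : Fin n → ℕ) (R : ℕ) (canon : Canonical code R) (c : Bool)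
  (x : Fin n → Bool) (j : ℕ) (i : Fin n) (e : Bool) (j≤ci : j ≤ code i)
  (below : ∀ k → code k < j → x k ≡ not (alt c (code k)))
  (others : ∀ k → k ≢ i → j ≤ code k → x k ≡ not e)
  (xi : x i ≡ e) (value : layered c R code x ≡ e) where

  ci<R : code i < R
  ci<R = proj₁ canon i

  alone⇒below-top : ∀ l → (∀ k → code k ≡ l → k ≡ i) → l < R → suc l < R
  alone⇒below-top l alone l<R with suc l <? R
  ... | yes sl<R = sl<R
  ... | no  sl≮R = ⊥-elim (proj₂ (proj₂ canon) i λ k ck → alone k (trans ck top≡l))
    where
    top≡l : pred R ≡ l
    top≡l = ≤-antisym (∸-monoˡ-≤ 1 (≮⇒≥ sl≮R)) (∸-monoˡ-≤ 1 l<R)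

  alone⇒code : ∀ l → (∀ k → code k ≡ l → k ≡ i) → l < R → code i ≡ l
  alone⇒code l alone l<R = let (k , ck) = proj₁ (proj₂ canon) l l<R in
    subst (λ z → code z ≡ l) (alone k ck) ck

  refute : ∀ t → t ≤ R → alt c t ≡ not e →
    (∀ k → k ≢ i → j ≤ code k → code k < t → alt c (code k) ≡ e) →
    (code i < t → alt c (code i) ≡ not e) →
    (t ≡ R ⊎ ∃ λ k → code k ≡ t × x k ≡ alt c t) → ⊥
  refute t t≤R alt≡ others-miss i-misses attained =
    b≢not-b (trans (sym value) (trans (layered-value c R code x t t≤R misses attained) alt≡))
    where
    misses : ∀ k → code k < t → x k ≡ not (alt c (code k))
    misses k ck<t with code k <? j | k ≟ᶠ i
    ... | yes ck<j | _       = below k ck<j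
    ... | no  _    | yes refl = trans xi (sym (trans (cong not (i-misses ck<t)) (not-involutive e)))
    ... | no  ck≮j | no k≢i  = trans (others k k≢i (≮⇒≥ ck≮j)) (cong not (sym (others-miss k k≢i (≮⇒≥ ck≮j) ck<t)))

  hit-at : ∀ t → t ≤ R → code i < t → alt c t ≡ not e →
    t ≡ R ⊎ ∃ λ k → code k ≡ t × x k ≡ alt c t
  hit-at t t≤R ci<t alt≡ with t <? R
  ... | no  t≮R = inj₁ (≤-antisym t≤R (≮⇒≥ t≮R))
  ... | yes t<R = let (k , ck) = proj₁ (proj₂ canon) t t<R in
    inj₂ (k , ck , trans (others k (λ { refl → <-irrefl ck ci<t })
                               (≤-trans (≤-trans j≤ci (<⇒≤ ci<t)) (≤-reflexive (sym ck))))
                         (sym alt≡))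

  -- If layer j has value not e we reach a contradiction: either another
  -- variable hits at layer j, or i is alone there and layer j+2 is hit.
  layer-value-not-e : alt c j ≡ not e → ⊥
  layer-value-not-e vj with alone-or-not code i j
  ... | inj₁ (k , k≢i , ck) =
    refute j (<⇒≤ (≤-<-trans j≤ci ci<R)) vj (λ _ _ j≤ ck<j → ⊥-elim (<⇒≱ ck<j j≤))
      (λ ci<j → ⊥-elim (<⇒≱ ci<j j≤ci))
      (inj₂ (k , ck , trans (others k k≢i (≤-reflexive (sym ck))) (sym vj)))
  ... | inj₂ alone =
    refute (2 + j) j+2≤R (trans (alt-twice c j) vj) others-miss
      (λ _ → trans (cong (alt c) ci≡j) vj)
      (hit-at (2 + j) j+2≤R (≤-trans (≤-reflexive (cong suc ci≡j)) (n≤1+n _)) (trans (alt-twice c j) vj))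
    where
    j<R = ≤-<-trans j≤ci ci<R
    ci≡j = alone⇒code j alone j<R
    j+2≤R = alone⇒below-top j alone j<R
    others-miss : ∀ k → k ≢ i → j ≤ code k → code k < 2 + j → alt c (code k) ≡ e
    others-miss k k≢i j≤ ck< with window2 j≤ ck<
    ... | inj₁ ck≡j  = ⊥-elim (k≢i (alone k ck≡j))
    ... | inj₂ ck≡sj = trans (cong (alt c) ck≡sj) (trans (cong not vj) (not-involutive e))

  -- If layer j has value e then i lies in layer j: otherwise either another
  -- variable hits at layer j+1, or i is alone there and layer j+3 is hit.
  layer-value-e : alt c j ≡ e → code i ≡ j
  layer-value-e vj with code i ≟ j
  ... | yes ci≡j = ci≡j
  ... | no  ci≢j with alone-or-not code i (suc j)
  ...   | inj₁ (k , k≢i , ck) = ⊥-elim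
    (refute (suc j) (≤-trans j<ci (<⇒≤ ci<R)) (cong not vj) others-miss
      (λ ci<sj → ⊥-elim (<⇒≱ ci<sj j<ci))
      (inj₂ (k , ck , trans (others k k≢i (≤-trans (n≤1+n j) (≤-reflexive (sym ck)))) (cong not (sym vj)))))
    where
    j<ci = ≤∧≢⇒< j≤ci (ci≢j ∘ sym)
    others-miss : ∀ k → k ≢ i → j ≤ code k → code k < suc j → alt c (code k) ≡ e
    others-miss k _ j≤ ck< = trans (cong (alt c) (≤-antisym (≤-pred ck<) j≤)) vj
  ...   | inj₂ alone = ⊥-elim
    (refute (3 + j) j+3≤R (trans (cong not (alt-twice c j)) (cong not vj)) others-miss
      (λ _ → trans (cong (alt c) ci≡sj) (cong not vj))
      (hit-at (3 + j) j+3≤R (≤-trans (≤-reflexive (cong suc ci≡sj)) (n≤1+n _))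
         (trans (cong not (alt-twice c j)) (cong not vj))))
    where
    j<ci = ≤∧≢⇒< j≤ci (ci≢j ∘ sym)
    sj<R = ≤-<-trans j<ci ci<R
    ci≡sj = alone⇒code (suc j) alone sj<R
    j+3≤R = alone⇒below-top (suc j) alone sj<R
    others-miss : ∀ k → k ≢ i → j ≤ code k → code k < 3 + j → alt c (code k) ≡ e
    others-miss k k≢i j≤ ck< with window3 j≤ ck<
    ... | inj₁ ck≡j = trans (cong (alt c) ck≡j) vj
    ... | inj₂ (inj₁ ck≡sj) = ⊥-elim (k≢i (alone k ck≡sj))
    ... | inj₂ (inj₂ ck≡ssj) = trans (cong (alt c) ck≡ssj) (trans (alt-twice c j) vj)

  layer-of-i : code i ≡ j × alt c j ≡ e
  layer-of-i with bool-cases (alt c j) e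
  ... | inj₁ vj = layer-value-e vj , vj
  ... | inj₂ vj = ⊥-elim (layer-value-not-e vj)

-- The probe point of module Probe, built
-- from the first function, is evaluated by the second.
module Compare {n} (codeA : Fin n → ℕ) (RA : ℕ) (canonA : Canonical codeA RA) (cA : Bool)
                   (codeB : Fin n → ℕ) (RB : ℕ) (canonB : Canonical codeB RB) (cB : Bool)
                   (same : ∀ x → layered cA RA codeA x ≡ layered cB RB codeB x) where

  layer-preserved : ∀ j →
    (∀ k → codeA k < j → codeB k ≡ codeA k) → (∀ k → codeB k < j → codeA k ≡ codeB k) →
    (∀ k → codeB k < j → alt cA (codeA k) ≡ alt cB (codeB k)) →
    ∀ i → codeA i ≡ j → codeB i ≡ j × alt cA j ≡ alt cB j
  layer-preserved j agreeA agreeB values i ci =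
    let (layer , value) = Probe.layer-of-i codeB RB canonB cB probe j i e j≤cBi below-B others
                            probe-i (trans (sym (same probe)) value-A)
    in layer , sym value
    where
    e = alt cA j
    probe : Fin n → Bool
    probe k with codeA k <? j | k ≟ᶠ i
    ... | yes _ | _     = not (alt cA (codeA k))
    ... | no _  | yes _ = e
    ... | no _  | no _  = not e
    probe-below : ∀ k → codeA k < j → probe k ≡ not (alt cA (codeA k))
    probe-below k lt with codeA k <? j
    ... | yes _  = refl
    ... | no  ≮ = ⊥-elim (≮ lt)
    probe-i : probe i ≡ e
    probe-i with codeA i <? j | i ≟ᶠ i
    ... | yes lt | _      = ⊥-elim (<-irrefl ci lt)
    ... | no _   | yes _  = refl
    ... | no _   | no i≢i = ⊥-elim (i≢i refl)
    probe-others : ∀ k → k ≢ i → ¬ codeA k < j → probe k ≡ not e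
    probe-others k k≢i ≮ with codeA k <? j | k ≟ᶠ i
    ... | yes lt | _       = ⊥-elim (≮ lt)
    ... | no _   | yes k≡i = ⊥-elim (k≢i k≡i)
    ... | no _   | no _    = refl
    value-A : layered cA RA codeA probe ≡ e
    value-A = layered-value cA RA codeA probe j (subst (_≤ RA) ci (<⇒≤ (proj₁ canonA i)))
                probe-below (inj₂ (i , ci , probe-i))
    j≤cBi : j ≤ codeB i
    j≤cBi with codeB i <? j
    ... | no  ≮  = ≮⇒≥ ≮
    ... | yes lt = ⊥-elim (<-irrefl (sym (trans (sym ci) (agreeB i lt))) lt)
    below-B : ∀ k → codeB k < j → probe k ≡ not (alt cB (codeB k))
    below-B k lt = trans (probe-below k (subst (_< j) (sym (agreeB k lt)) lt)) (cong not (values k lt))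
    others : ∀ k → k ≢ i → j ≤ codeB k → probe k ≡ not e
    others k k≢i j≤ = probe-others k k≢i (λ lt → <⇒≱ (subst (_< j) (sym (agreeA k lt)) lt) j≤)

layered-injective : ∀ {n} (cA : Bool) RA (codeA : Fin n → ℕ) (cB : Bool) RB (codeB : Fin n → ℕ) →
  Canonical codeA RA → Canonical codeB RB → Fin n →
  (∀ x → layered cA RA codeA x ≡ layered cB RB codeB x) →
  cA ≡ cB × (∀ i → codeA i ≡ codeB i) × RA ≡ RB
layered-injective {n} cA RA codeA cB RB codeB canonA canonB i₀ same =
  same-start , same-code , same-R
  where
  module AB = Compare codeA RA canonA cA codeB RB canonB cB same
  module BA = Compare codeB RB canonB cB codeA RA canonA cA (sym ∘ same)

  -- a variable of layer 0 shows that the start values agree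
  same-start : cA ≡ cB
  same-start =
    let (i , ci) = proj₁ (proj₂ canonA) 0 (≤-<-trans z≤n (proj₁ canonA i₀))
    in proj₂ (AB.layer-preserved 0 (λ _ ()) (λ _ ()) (λ _ ()) i ci)

  agree-below : ∀ j → (∀ k → codeA k < j → codeB k ≡ codeA k) × (∀ k → codeB k < j → codeA k ≡ codeB k)
  agree-below zero    = (λ _ ()) , (λ _ ())
  agree-below (suc j) = extendA , extendB
    where
    IH = agree-below j
    extendA : ∀ k → codeA k < suc j → codeB k ≡ codeA k
    extendA k lt with m≤n⇒m<n∨m≡n (≤-pred lt)
    ... | inj₁ lt′ = proj₁ IH k lt′
    ... | inj₂ eq  = trans (proj₁ (AB.layer-preserved j (proj₁ IH) (proj₂ IH)
                       (λ k′ lt′ → cong₂ alt same-start (proj₂ IH k′ lt′)) k eq)) (sym eq)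
    extendB : ∀ k → codeB k < suc j → codeA k ≡ codeB k
    extendB k lt with m≤n⇒m<n∨m≡n (≤-pred lt)
    ... | inj₁ lt′ = proj₂ IH k lt′
    ... | inj₂ eq  = trans (proj₁ (BA.layer-preserved j (proj₂ IH) (proj₁ IH)
                       (λ k′ lt′ → cong₂ alt (sym same-start) (proj₁ IH k′ lt′)) k eq)) (sym eq)

  same-code : ∀ i → codeA i ≡ codeB i
  same-code i = sym (proj₁ (agree-below (suc (codeA i))) i ≤-refl)

  -- both codes are onto their layer ranges
  same-R : RA ≡ RB
  same-R with <-cmp RA RB
  ... | tri≈ _ eq _ = eq
  ... | tri< lt _ _ = let (i , ci) = proj₁ (proj₂ canonB) RA lt in
    ⊥-elim (<-irrefl (trans (same-code i) ci) (proj₁ canonA i))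
  ... | tri> _ _ gt = let (i , ci) = proj₁ (proj₂ canonA) RB gt in
    ⊥-elim (<-irrefl (trans (sym (same-code i)) ci) (proj₁ canonB i))

first-true : ∀ {n} (p : Fin n → Bool) →
  (∃ λ k → p k ≡ true × ∀ j → j <ᶠ k → p j ≡ false) ⊎ (∀ j → p j ≡ false)
first-true {zero}  p = inj₂ λ ()
first-true {suc n} p with p zero in p0
... | true = inj₁ (zero , p0 , λ _ ())
... | false with first-true (p ∘ suc)
...   | inj₂ none            = inj₂ λ { zero → p0 ; (suc j) → none j }
...   | inj₁ (k , pk , before) =
  inj₁ (suc k , pk , λ { zero _ → p0 ; (suc j) (s≤s lt) → before j lt })

nestedCanalyzing-ext : ∀ {m} (f : BF (suc m)) σ a b → NestedCanalyzingWith f σ a b →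
  ∀ x y → (∀ i → x i ≡ y i) → f x ≡ f y
nestedCanalyzing-ext f σ a b (canalyzed , default) x y eq
  with first-true (λ k → sameᵇ (x (σ ⟨$⟩ʳ k)) (a k))
... | inj₁ (k , hit , before) =
  trans (canalyzed x k (λ j lt → sameᵇ-false (before j lt)) (sameᵇ-true hit))
        (sym (canalyzed y k (λ j lt → trans (sym (eq _)) (sameᵇ-false (before j lt)))
                            (trans (sym (eq _)) (sameᵇ-true hit))))
... | inj₂ none =
  trans (default x (λ j → sameᵇ-false (none j)))
        (sym (default y (λ j → trans (sym (eq _)) (sameᵇ-false (none j)))))

nestedCanalyzing-cong : ∀ {m} (f : BF (suc m)) σ a b a′ b′ → NestedCanalyzingWith f σ a b →
  (∀ k → a k ≡ a′ k) → (∀ k → b k ≡ b′ k) → NestedCanalyzingWith f σ a′ b′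
nestedCanalyzing-cong f σ a b a′ b′ (canalyzed , default) ea eb =
  (λ x k before xk → trans (canalyzed x k (λ j lt → trans (before j lt) (cong not (sym (ea j))))
                                          (trans xk (sym (ea k))))
                           (eb k)) ,
  (λ x all → trans (default x (λ j → trans (all j) (cong not (sym (ea j))))) (cong not (eb _)))

pick : Bool → Bool → Bool
pick true  a = a
pick false a = not a

indicator : ∀ {n} → Fin n → Fin n → Bool
indicator k j with j ≟ᶠ k
... | yes _ = true
... | no  _ = false

indicator-self : ∀ {n} (k : Fin n) → indicator k k ≡ true
indicator-self k with k ≟ᶠ k
... | yes _   = refl
... | no  k≢k = ⊥-elim (k≢k refl)

indicator-other : ∀ {n} (k j : Fin n) → j ≢ k → indicator k j ≡ false
indicator-other k j j≢k with j ≟ᶠ k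
... | yes j≡k = ⊥-elim (j≢k j≡k)
... | no  _   = refl

not-≤ᴮ-self : ∀ {b} → not b ≤ᴮ b → b ≡ true
not-≤ᴮ-self {true} _ = refl

≤ᴮ-not-self : ∀ {b} → b ≤ᴮ not b → b ≡ false
≤ᴮ-not-self {false} _ = refl

-- For a monotone increasing NCF every canalyzing value equals the
-- corresponding canalyzed value.  Inputs are described by patterns h: the
-- variable at sorted position j takes its canalyzing value iff h j.
module IncreasingNCF {m} (f : BF (suc m)) (σ : Permutation′ (suc m)) (a b : Fin (suc m) → Bool)
                     (nc : NestedCanalyzingWith f σ a b) (inc : MonotoneIncreasing f) where

  point : (Fin (suc m) → Bool) → Fin (suc m) → Bool
  point h i = pick (h (σ ⟨$⟩ˡ i)) (a (σ ⟨$⟩ˡ i))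

  point-σ : ∀ h j → point h (σ ⟨$⟩ʳ j) ≡ pick (h j) (a j)
  point-σ h j = cong (λ z → pick (h z) (a z)) (inverseˡ σ)

  value-first : ∀ h k → h k ≡ true → (∀ j → j <ᶠ k → h j ≡ false) → f (point h) ≡ b k
  value-first h k hk before = proj₁ nc (point h) k
    (λ j lt → trans (point-σ h j) (cong (λ z → pick z (a j)) (before j lt)))
    (trans (point-σ h k) (cong (λ z → pick z (a k)) hk))

  value-none : f (point (λ _ → false)) ≡ not (b (fromℕ m))
  value-none = proj₂ nc (point (λ _ → false)) (point-σ (λ _ → false))

  compare-points : ∀ h₁ h₀ k → h₁ k ≡ true → h₀ k ≡ false → (∀ j → j ≢ k → h₁ j ≡ h₀ j) →
    (a k ≡ true → point h₀ ≼ point h₁) × (a k ≡ false → point h₁ ≼ point h₀)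
  compare-points h₁ h₀ k e₁ e₀ eq = (λ ak i → up ak (σ ⟨$⟩ˡ i)) , (λ ak i → down ak (σ ⟨$⟩ˡ i))
    where
    up : a k ≡ true → ∀ j → pick (h₀ j) (a j) ≤ᴮ pick (h₁ j) (a j)
    up ak j with j ≟ᶠ k
    ... | yes refl rewrite e₁ | e₀ | ak = f≤t
    ... | no j≢k   rewrite eq j j≢k     = b≤b
    down : a k ≡ false → ∀ j → pick (h₁ j) (a j) ≤ᴮ pick (h₀ j) (a j)
    down ak j with j ≟ᶠ k
    ... | yes refl rewrite e₁ | e₀ | ak = f≤t
    ... | no j≢k   rewrite eq j j≢k     = b≤b

  switch⇒equal : ∀ h₁ h₀ k → h₁ k ≡ true → h₀ k ≡ false → (∀ j → j ≢ k → h₁ j ≡ h₀ j) →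
    f (point h₁) ≡ b k → f (point h₀) ≡ not (b k) → a k ≡ b k
  switch⇒equal h₁ h₀ k e₁ e₀ eq v₁ v₀ with a k in ak
  ... | true  = sym (not-≤ᴮ-self (subst₂ _≤ᴮ_ v₀ v₁ (inc _ _ (proj₁ (compare-points h₁ h₀ k e₁ e₀ eq) ak))))
  ... | false = sym (≤ᴮ-not-self (subst₂ _≤ᴮ_ v₁ v₀ (inc _ _ (proj₂ (compare-points h₁ h₀ k e₁ e₀ eq) ak))))

  -- Switch position k alone, on top of nothing when b k = b last, and on top
  -- of the last position otherwise.
  canalyzing≡canalyzed : ∀ k → a k ≡ b k
  canalyzing≡canalyzed k with bool-cases (b (fromℕ m)) (b k)
  ... | inj₁ same =
    switch⇒equal (indicator k) (λ _ → false) k (indicator-self k) refl (indicator-other k)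
      (value-first (indicator k) k (indicator-self k) (λ j lt → indicator-other k j (<ᶠ⇒≢ lt)))
      (trans value-none (cong not same))
  ... | inj₂ differ =
    switch⇒equal with-k (indicator L) k k∈with-k (indicator-other L k k≢L)
      (λ j j≢k → cong (_∨ indicator L j) (indicator-other k j j≢k))
      (value-first with-k k k∈with-k
         (λ j lt → cong₂ _∨_ (indicator-other k j (<ᶠ⇒≢ lt)) (indicator-other L j (<-last⇒≢ j k lt))))
      (trans (value-first (indicator L) L (indicator-self L) (λ j lt → indicator-other L j (<ᶠ⇒≢ lt)))
             differ)
    where
    L = fromℕ m
    k≢L : k ≢ L
    k≢L refl = b≢not-b differ
    with-k : Fin (suc m) → Bool
    with-k j = indicator k j ∨ indicator L j
    k∈with-k : with-k k ≡ true
    k∈with-k = cong (_∨ indicator L k) (indicator-self k)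

-- Flipping the last canalyzing and canalyzed values of an NCF gives another
-- NCF description of the same function: the last variable then canalyzes
-- to the former default value.
flipLast : ∀ {m} → (Fin (suc m) → Bool) → Fin (suc m) → Bool
flipLast {m} a k with k ≟ᶠ fromℕ m
... | yes _ = not (a k)
... | no  _ = a k

flipLast-last : ∀ {m} (a : Fin (suc m) → Bool) → flipLast a (fromℕ m) ≡ not (a (fromℕ m))
flipLast-last {m} a with fromℕ m ≟ᶠ fromℕ m
... | yes _   = refl
... | no  L≢L = ⊥-elim (L≢L refl)

flipLast-other : ∀ {m} (a : Fin (suc m) → Bool) k → k ≢ fromℕ m → flipLast a k ≡ a k
flipLast-other {m} a k k≢L with k ≟ᶠ fromℕ m
... | yes k≡L = ⊥-elim (k≢L k≡L)
... | no  _   = refl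

flipLast-nestedCanalyzing : ∀ {m} (f : BF (suc m)) σ a b → NestedCanalyzingWith f σ a b →
  NestedCanalyzingWith f σ (flipLast a) (flipLast b)
flipLast-nestedCanalyzing {m} f σ a b (canalyzed , default) = canalyzed′ , default′
  where
  L = fromℕ m
  earlier-unflipped : ∀ x k → (∀ j → j <ᶠ k → x (σ ⟨$⟩ʳ j) ≡ not (flipLast a j)) →
    ∀ j → j <ᶠ k → x (σ ⟨$⟩ʳ j) ≡ not (a j)
  earlier-unflipped x k before j lt = trans (before j lt) (cong not (flipLast-other a j (<-last⇒≢ j k lt)))
  all-miss : ∀ x → (∀ j → j <ᶠ L → x (σ ⟨$⟩ʳ j) ≡ not (a j)) → x (σ ⟨$⟩ʳ L) ≡ flipLast a L →
    ∀ j → x (σ ⟨$⟩ʳ j) ≡ not (a j)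
  all-miss x before xL j with j ≟ᶠ L
  ... | yes refl = trans xL (flipLast-last a)
  ... | no  j≢L  = before j (≤∧≢⇒< (≤-last j) (j≢L ∘ toℕ-injective))
  canalyzed′ : ∀ x k → (∀ j → j <ᶠ k → x (σ ⟨$⟩ʳ j) ≡ not (flipLast a j)) →
    x (σ ⟨$⟩ʳ k) ≡ flipLast a k → f x ≡ flipLast b k
  canalyzed′ x k before xk = by-position (k ≟ᶠ L)
    where
    by-position : Dec (k ≡ L) → f x ≡ flipLast b k
    by-position (yes refl) = trans (default x (all-miss x (earlier-unflipped x L before) xk))
                                   (sym (flipLast-last b))
    by-position (no k≢L)   = trans (canalyzed x k (earlier-unflipped x k before) (trans xk (flipLast-other a k k≢L)))
                                   (sym (flipLast-other b k k≢L))
  default′ : ∀ x → (∀ j → x (σ ⟨$⟩ʳ j) ≡ not (flipLast a j)) → f x ≡ not (flipLast b L)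
  default′ x all = trans
    (canalyzed x L (earlier-unflipped x L (λ j _ → all j))
                   (trans (all L) (trans (cong not (flipLast-last a)) (not-involutive _))))
    (sym (trans (cong not (flipLast-last b)) (not-involutive _)))

-- changes g j counts the value changes of g along 0,…,j; it numbers the
-- maximal blocks of equal values.
changes : (ℕ → Bool) → ℕ → ℕ
changes g zero    = zero
changes g (suc j) = if sameᵇ (g (suc j)) (g j) then changes g j else suc (changes g j)

module Changes (g : ℕ → Bool) where

  value : ∀ j → g j ≡ alt (g 0) (changes g j)
  value zero    = refl
  value (suc j) with sameᵇ (g (suc j)) (g j) in e
  ... | true  = trans (sameᵇ-true e) (value j)
  ... | false = trans (sameᵇ-false e) (cong not (value j))

  step-≤ : ∀ j → changes g j ≤ changes g (suc j)
  step-≤ j with sameᵇ (g (suc j)) (g j)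
  ... | true  = ≤-refl
  ... | false = n≤1+n _

  step-≤1 : ∀ j → changes g (suc j) ≤ suc (changes g j)
  step-≤1 j with sameᵇ (g (suc j)) (g j)
  ... | true  = n≤1+n _
  ... | false = ≤-refl

  step-same : ∀ j → g (suc j) ≡ g j → changes g (suc j) ≡ changes g j
  step-same j e with sameᵇ (g (suc j)) (g j) in e′
  ... | true  = refl
  ... | false = ⊥-elim (b≢not-b (trans (sym e) (sameᵇ-false e′)))

  monotone : ∀ {j j′} → j ≤ j′ → changes g j ≤ changes g j′
  monotone {j} {j′} le with m≤n⇒m<n∨m≡n le
  ... | inj₂ refl = ≤-refl
  ... | inj₁ lt   = go j′ lt
    where
    go : ∀ j′ → j < j′ → changes g j ≤ changes g j′
    go (suc j′) lt with m≤n⇒m<n∨m≡n (≤-pred lt)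
    ... | inj₂ refl = step-≤ j
    ... | inj₁ lt′  = ≤-trans (go j′ lt′) (step-≤ j′)

  reflect-< : ∀ {j j′} → changes g j < changes g j′ → j < j′
  reflect-< {j} {j′} lt with j <? j′
  ... | yes p = p
  ... | no ¬p = ⊥-elim (<⇒≱ lt (monotone (≮⇒≥ ¬p)))

  intermediate : ∀ j l → l ≤ changes g j → ∃ λ j′ → j′ ≤ j × changes g j′ ≡ l
  intermediate zero    l le = 0 , z≤n , sym (n≤0⇒n≡0 le)
  intermediate (suc j) l le with m≤n⇒m<n∨m≡n le
  ... | inj₂ e  = suc j , ≤-refl , sym e
  ... | inj₁ lt = let (j′ , j′≤j , e) = intermediate j l (≤-pred (<-≤-trans lt (step-≤1 j))) in
    j′ , m≤n⇒m≤1+n j′≤j , e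

-- a natural number as a position in Fin (suc m), saturating at the last one
clamp : ∀ {m} → ℕ → Fin (suc m)
clamp {m}     zero    = zero
clamp {zero}  (suc j) = zero
clamp {suc m} (suc j) = suc (clamp {m} j)

clamp-toℕ : ∀ {m} (k : Fin (suc m)) → clamp (toℕ k) ≡ k
clamp-toℕ {m}     zero    = refl
clamp-toℕ {suc m} (suc k) = cong suc (clamp-toℕ k)

toℕ-clamp : ∀ {m} j → j ≤ m → toℕ (clamp {m} j) ≡ j
toℕ-clamp {m}     zero    _        = refl
toℕ-clamp {suc m} (suc j) (s≤s le) = cong suc (toℕ-clamp j le)

clamp-last : ∀ m → clamp {m} m ≡ fromℕ m
clamp-last m = toℕ-injective (trans (toℕ-clamp m ≤-refl) (sym (toℕ-fromℕ m)))

LayeredRep : ∀ {n} → BF n → Set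
LayeredRep {n} f = ∃ λ c → ∃ λ R → ∃ λ (code : Fin n → ℕ) → Canonical code R × f ≐ layered c R code

-- An NCF on at least two variables whose canalyzing and canalyzed values
-- coincide, and whose last two canalyzed values are equal, is a canonical
-- layered function: the layer of a variable is the number of changes of
-- the canalyzed values up to its position.
module FromNCF {m} (f : BF (suc (suc m))) (σ : Permutation′ (suc (suc m))) (b : Fin (suc (suc m)) → Bool)
               (nc : NestedCanalyzingWith f σ b b) (last-two : b (clamp (suc m)) ≡ b (clamp m)) where

  bℕ : ℕ → Bool
  bℕ j = b (clamp j)

  open Changes bℕ

  c : Bool
  c = bℕ 0

  code : Fin (suc (suc m)) → ℕ
  code i = changes bℕ (toℕ (σ ⟨$⟩ˡ i))

  R : ℕ
  R = suc (changes bℕ (suc m))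

  b-layer : ∀ k → b k ≡ alt c (changes bℕ (toℕ k))
  b-layer k = trans (cong b (sym (clamp-toℕ k))) (value (toℕ k))

  code-σ : ∀ k → code (σ ⟨$⟩ʳ k) ≡ changes bℕ (toℕ k)
  code-σ k = cong (changes bℕ ∘ toℕ) (inverseˡ σ)

  code-at : ∀ j → j ≤ suc m → code (σ ⟨$⟩ʳ clamp j) ≡ changes bℕ j
  code-at j j≤ = trans (code-σ (clamp j)) (cong (changes bℕ) (toℕ-clamp j j≤))

  -- the top layer holds the last two sorted variables
  top-not-singleton : ∀ i → ¬ (∀ k → code k ≡ pred R → k ≡ i)
  top-not-singleton i only = <-irrefl (sym last≡prev) (n<1+n m)
    where
    last = only (σ ⟨$⟩ʳ clamp (suc m)) (code-at (suc m) ≤-refl)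
    prev = only (σ ⟨$⟩ʳ clamp m) (trans (code-at m (n≤1+n m)) (sym (step-same m last-two)))
    same-position : clamp {suc m} (suc m) ≡ clamp m
    same-position = trans (sym (inverseˡ σ)) (trans (cong (σ ⟨$⟩ˡ_) (trans last (sym prev))) (inverseˡ σ))
    last≡prev : suc m ≡ m
    last≡prev = trans (sym (toℕ-clamp (suc m) ≤-refl)) (trans (cong toℕ same-position) (toℕ-clamp m (n≤1+n m)))

  canonical : Canonical code R
  canonical = (λ i → s≤s (monotone (toℕ≤pred[n] (σ ⟨$⟩ˡ i)))) , onto , top-not-singleton
    where
    onto : ∀ l → l < R → ∃ λ i → code i ≡ l
    onto l lt = let (j , j≤ , e) = intermediate (suc m) l (≤-pred lt) in
      σ ⟨$⟩ʳ clamp j , trans (code-at j j≤) e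

  misses : ∀ (x : Fin (suc (suc m)) → Bool) i (P : Fin (suc (suc m)) → Set) → P (σ ⟨$⟩ˡ i) →
    (∀ j → P j → x (σ ⟨$⟩ʳ j) ≡ not (b j)) → x i ≡ not (alt c (code i))
  misses x i P p h = trans (sym (cong x (inverseʳ σ))) (trans (h (σ ⟨$⟩ˡ i) p) (cong not (b-layer (σ ⟨$⟩ˡ i))))

  -- both functions are determined by the first sorted position that hits
  represents : f ≐ layered c R code
  represents x with first-true (λ k → sameᵇ (x (σ ⟨$⟩ʳ k)) (b k))
  ... | inj₁ (k , hit , before) =
    trans (proj₁ nc x k before′ (sameᵇ-true hit)) (trans (b-layer k) (sym
      (layered-value c R code x (changes bℕ (toℕ k)) (m≤n⇒m≤1+n (monotone (toℕ≤pred[n] k)))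
         (λ i lt → misses x i (_<ᶠ k) (reflect-< lt) before′)
         (inj₂ (σ ⟨$⟩ʳ k , code-σ k , trans (sameᵇ-true hit) (b-layer k))))))
    where
    before′ : ∀ j → j <ᶠ k → x (σ ⟨$⟩ʳ j) ≡ not (b j)
    before′ j lt = sameᵇ-false (before j lt)
  ... | inj₂ none =
    trans (proj₂ nc x all) (trans (cong not (trans (cong b (sym (clamp-last (suc m)))) (value (suc m))))
      (sym (layered-value c R code x R ≤-refl (λ i _ → misses x i (λ _ → ⊤) tt (λ j _ → all j)) (inj₁ refl))))
    where
    all : ∀ j → x (σ ⟨$⟩ʳ j) ≡ not (b j)
    all j = sameᵇ-false (none j)

  representation : LayeredRep f
  representation = c , R , code , canonical , represents

-- Every monotone increasing NCF on at least two variables is a canonical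
-- layered function.  If its last two canalyzed values differ, flip the last
-- pair first.
increasing-layered : ∀ {m} (f : BF (suc (suc m))) → MonotoneIncreasing f → NestedCanalyzing f → LayeredRep f
increasing-layered {m} f inc (σ , a , b , nc) with bool-cases (b (clamp (suc m))) (b (clamp m))
... | inj₁ last-two = FromNCF.representation f σ b nc-b last-two
  where
  nc-b = nestedCanalyzing-cong f σ a b b b nc (IncreasingNCF.canalyzing≡canalyzed f σ a b nc inc) (λ _ → refl)
... | inj₂ differ   = FromNCF.representation f σ (flipLast b) nc-flipped last-two
  where
  nc-flipped = flipLast-nestedCanalyzing f σ b b
    (nestedCanalyzing-cong f σ a b b b nc (IncreasingNCF.canalyzing≡canalyzed f σ a b nc inc) (λ _ → refl))
  prev≢last : clamp {suc m} m ≢ fromℕ (suc m)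
  prev≢last e = <-irrefl (trans (sym (toℕ-clamp m (n≤1+n m))) (trans (cong toℕ e) (toℕ-fromℕ (suc m)))) (n<1+n m)
  last-two : flipLast b (clamp (suc m)) ≡ flipLast b (clamp m)
  last-two = begin
    flipLast b (clamp (suc m)) ≡⟨ cong (flipLast b) (clamp-last (suc m)) ⟩
    flipLast b (fromℕ (suc m)) ≡⟨ flipLast-last b ⟩
    not (b (fromℕ (suc m)))    ≡⟨ cong (not ∘ b) (clamp-last (suc m)) ⟨
    not (b (clamp (suc m)))    ≡⟨ cong not differ ⟩
    not (not (b (clamp m)))    ≡⟨ not-involutive _ ⟩
    b (clamp m)                ≡⟨ flipLast-other b _ prev≢last ⟨
    flipLast b (clamp m)       ∎
    where open ≡-Reasoning

decreasing-layered : ∀ {m} (f : BF (suc (suc m))) → MonotoneDecreasing f → NestedCanalyzing f →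
  ∃ λ c → ∃ λ R → ∃ λ (code : Fin (suc (suc m)) → ℕ) →
    Canonical code R × (∀ x → f x ≡ layered c R code (not ∘ x))
decreasing-layered f dec (σ , a , b , nc) =
  let (c , R , code , canonical , represents) = increasing-layered (f ∘ (not ∘_)) (negate-decreasing f dec)
                                                  (σ , not ∘ a , b , negate-nestedCanalyzing f σ a b nc)
  in c , R , code , canonical , λ x →
       trans (nestedCanalyzing-ext f σ a b nc x (not ∘ (not ∘ x)) (sym ∘ not-involutive ∘ x))
             (represents (not ∘ x))

-- A code of n variables is stored as the list of
-- its n values.  The lists of length N taking each value l < r exactly
-- kₗ times are built layer by layer: choose the positions of value 0, then
-- place a list for the remaining layers, raised by one, on the other
-- positions.

subsets : ℕ → ℕ → List (List Bool)
subsets zero    zero    = [] ∷ []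
subsets zero    (suc k) = []
subsets (suc N) zero    = map (false ∷_) (subsets N zero)
subsets (suc N) (suc k) = map (true ∷_) (subsets N k) ++ map (false ∷_) (subsets N (suc k))

trues : List Bool → ℕ
trues []           = 0
trues (true ∷ bs)  = suc (trues bs)
trues (false ∷ bs) = trues bs

falses : List Bool → ℕ
falses []           = 0
falses (true ∷ bs)  = falses bs
falses (false ∷ bs) = suc (falses bs)

interleave : List Bool → List ℕ → List ℕ
interleave []           rs       = []
interleave (true ∷ ms)  rs       = 0 ∷ interleave ms rs
interleave (false ∷ ms) []       = 1 ∷ interleave ms []
interleave (false ∷ ms) (r ∷ rs) = suc r ∷ interleave ms rs

codeLists : List ℕ → ℕ → List (List ℕ)
codeLists []       zero    = [] ∷ []
codeLists []       (suc N) = []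
codeLists (k ∷ ks) N       = concatMap (λ ms → map (interleave ms) (codeLists ks (N ∸ k))) (subsets N k)

isZero : ℕ → Bool
isZero zero    = true
isZero (suc _) = false

lower : List ℕ → List ℕ
lower []           = []
lower (zero ∷ xs)  = lower xs
lower (suc x ∷ xs) = x ∷ lower xs

count : ℕ → List ℕ → ℕ
count l []       = 0
count l (x ∷ xs) = if x ≡ᵇ l then suc (count l xs) else count l xs

fiberSizes : List ℕ → ℕ → List ℕ
fiberSizes cs zero    = []
fiberSizes cs (suc r) = count 0 cs ∷ fiberSizes (lower cs) r

subsets-sound : ∀ N k bs → bs ∈ subsets N k → length bs ≡ N × trues bs ≡ k
subsets-sound zero    zero    .[] (here refl) = refl , refl
subsets-sound (suc N) zero    bs p with ∈-map⁻ (false ∷_) p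
... | bs′ , q , refl = let (len , t) = subsets-sound N zero bs′ q in cong suc len , t
subsets-sound (suc N) (suc k) bs p with ∈-++⁻ (map (true ∷_) (subsets N k)) p
... | inj₁ p′ with ∈-map⁻ (true ∷_) p′
...   | bs′ , q , refl = let (len , t) = subsets-sound N k bs′ q in cong suc len , cong suc t
subsets-sound (suc N) (suc k) bs p | inj₂ p′ with ∈-map⁻ (false ∷_) p′
...   | bs′ , q , refl = let (len , t) = subsets-sound N (suc k) bs′ q in cong suc len , t

subsets-complete : ∀ bs → bs ∈ subsets (length bs) (trues bs)
subsets-complete []           = here refl
subsets-complete (true ∷ bs)  = ∈-++⁺ˡ (∈-map⁺ (true ∷_) (subsets-complete bs))
subsets-complete (false ∷ bs) with trues bs | subsets-complete bs
... | zero  | p = ∈-map⁺ (false ∷_) p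
... | suc t | p = ∈-++⁺ʳ (map (true ∷_) (subsets (length bs) t)) (∈-map⁺ (false ∷_) p)

∷-injectiveʳ : ∀ {A : Set} {x y : A} {xs ys : List A} → x ∷ xs ≡ y ∷ ys → xs ≡ ys
∷-injectiveʳ refl = refl

subsets-unique : ∀ N k → Unique (subsets N k)
subsets-unique zero    zero    = [] ∷ []
subsets-unique zero    (suc k) = []
subsets-unique (suc N) zero    = map-unique (false ∷_) _ (subsets-unique N zero) (λ _ _ → ∷-injectiveʳ)
subsets-unique (suc N) (suc k) = AllPairsP.++⁺
  (map-unique (true ∷_) _ (subsets-unique N k) (λ _ _ → ∷-injectiveʳ))
  (map-unique (false ∷_) _ (subsets-unique N (suc k)) (λ _ _ → ∷-injectiveʳ))
  (All.tabulate λ y∈ → All.tabulate λ z∈ y≡z →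
     let (_ , _ , ey) = ∈-map⁻ (true ∷_) y∈ ; (_ , _ , ez) = ∈-map⁻ (false ∷_) z∈
     in true≢false (cong (head′ true) (trans (sym ey) (trans y≡z ez))))
  where
  head′ : Bool → List Bool → Bool
  head′ d []      = d
  head′ d (b ∷ _) = b
  true≢false : true ≢ false
  true≢false ()

length-subsets : ∀ N k → length (subsets N k) ≡ N C k
length-subsets zero    zero    = refl
length-subsets zero    (suc k) = refl
length-subsets (suc N) zero    = trans (length-map _ (subsets N zero)) (length-subsets N zero)
length-subsets (suc N) (suc k) = begin
  length (map (true ∷_) (subsets N k) ++ map (false ∷_) (subsets N (suc k)))
    ≡⟨ length-++ (map (true ∷_) (subsets N k)) ⟩
  length (map (true ∷_) (subsets N k)) + length (map (false ∷_) (subsets N (suc k)))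
    ≡⟨ cong₂ _+_ (length-map _ (subsets N k)) (length-map _ (subsets N (suc k))) ⟩
  length (subsets N k) + length (subsets N (suc k))
    ≡⟨ cong₂ _+_ (length-subsets N k) (length-subsets N (suc k)) ⟩
  N C k + N C suc k
    ≡⟨ nCk+nC[k+1]≡[n+1]C[k+1] N k ⟩
  suc N C suc k ∎
  where open ≡-Reasoning

trues+falses : ∀ bs → trues bs + falses bs ≡ length bs
trues+falses []           = refl
trues+falses (true ∷ bs)  = cong suc (trues+falses bs)
trues+falses (false ∷ bs) = trans (+-suc (trues bs) (falses bs)) (cong suc (trues+falses bs))

subsets-falses : ∀ N k bs → bs ∈ subsets N k → falses bs ≡ N ∸ k
subsets-falses N k bs p = let (len , t) = subsets-sound N k bs p in
  trans (sym (m+n∸m≡n (trues bs) (falses bs)))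
        (trans (cong (_∸ trues bs) (trues+falses bs)) (cong₂ _∸_ len t))

length-interleave : ∀ ms rs → length (interleave ms rs) ≡ length ms
length-interleave []           rs       = refl
length-interleave (true ∷ ms)  rs       = cong suc (length-interleave ms rs)
length-interleave (false ∷ ms) []       = cong suc (length-interleave ms [])
length-interleave (false ∷ ms) (r ∷ rs) = cong suc (length-interleave ms rs)

isZero-interleave : ∀ ms rs → map isZero (interleave ms rs) ≡ ms
isZero-interleave []           rs       = refl
isZero-interleave (true ∷ ms)  rs       = cong (true ∷_) (isZero-interleave ms rs)
isZero-interleave (false ∷ ms) []       = cong (false ∷_) (isZero-interleave ms [])
isZero-interleave (false ∷ ms) (r ∷ rs) = cong (false ∷_) (isZero-interleave ms rs)

lower-interleave : ∀ ms rs → falses ms ≡ length rs → lower (interleave ms rs) ≡ rs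
lower-interleave []           []       _ = refl
lower-interleave (true ∷ ms)  rs       e = lower-interleave ms rs e
lower-interleave (false ∷ ms) (r ∷ rs) e = cong (r ∷_) (lower-interleave ms rs (suc-injective e))

count0-interleave : ∀ ms rs → count 0 (interleave ms rs) ≡ trues ms
count0-interleave []           rs       = refl
count0-interleave (true ∷ ms)  rs       = cong suc (count0-interleave ms rs)
count0-interleave (false ∷ ms) []       = count0-interleave ms []
count0-interleave (false ∷ ms) (r ∷ rs) = count0-interleave ms rs

interleave-bounded : ∀ r ms rs → falses ms ≡ length rs → All (_< r) rs → All (_< suc r) (interleave ms rs)
interleave-bounded r []           rs       _ _        = []
interleave-bounded r (true ∷ ms)  rs       e bs       = s≤s z≤n ∷ interleave-bounded r ms rs e bs
interleave-bounded r (false ∷ ms) (x ∷ rs) e (b ∷ bs) = s≤s b ∷ interleave-bounded r ms rs (suc-injective e) bs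

interleave-split : ∀ cs → interleave (map isZero cs) (lower cs) ≡ cs
interleave-split []           = refl
interleave-split (zero ∷ cs)  = cong (0 ∷_) (interleave-split cs)
interleave-split (suc x ∷ cs) = cong (suc x ∷_) (interleave-split cs)

trues-isZero : ∀ cs → trues (map isZero cs) ≡ count 0 cs
trues-isZero []           = refl
trues-isZero (zero ∷ cs)  = cong suc (trues-isZero cs)
trues-isZero (suc x ∷ cs) = trues-isZero cs

count≤length : ∀ l cs → count l cs ≤ length cs
count≤length l []       = z≤n
count≤length l (x ∷ cs) with x ≡ᵇ l
... | true  = s≤s (count≤length l cs)
... | false = m≤n⇒m≤1+n (count≤length l cs)

length-lower : ∀ cs → length (lower cs) ≡ length cs ∸ count 0 cs
length-lower []           = refl
length-lower (zero ∷ cs)  = length-lower cs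
length-lower (suc x ∷ cs) = trans (cong suc (length-lower cs)) (sym (+-∸-assoc 1 (count≤length 0 cs)))

lower-bounded : ∀ r cs → All (_< suc r) cs → All (_< r) (lower cs)
lower-bounded r []           _              = []
lower-bounded r (zero ∷ cs)  (_ ∷ bs)       = lower-bounded r cs bs
lower-bounded r (suc x ∷ cs) (s≤s b ∷ bs)  = b ∷ lower-bounded r cs bs

codeLists-sound : ∀ ks N cs → cs ∈ codeLists ks N →
  length cs ≡ N × All (_< length ks) cs × fiberSizes cs (length ks) ≡ ks
codeLists-sound []       zero .[] (here refl) = refl , [] , refl
codeLists-sound (k ∷ ks) N    cs  p
  with ∈-concatMap⁻′ (λ ms → map (interleave ms) (codeLists ks (N ∸ k))) p
... | ms , ms∈ , q with ∈-map⁻ (interleave ms) q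
...   | rs , rs∈ , refl =
  let (len-ms , trues-ms) = subsets-sound N k ms ms∈
      (len-rs , bounded , fibers) = codeLists-sound ks (N ∸ k) rs rs∈
      fits = trans (subsets-falses N k ms ms∈) (sym len-rs)
  in trans (length-interleave ms rs) len-ms ,
     interleave-bounded (length ks) ms rs fits bounded ,
     cong₂ _∷_ (trans (count0-interleave ms rs) trues-ms)
               (trans (cong (λ z → fiberSizes z (length ks)) (lower-interleave ms rs fits)) fibers)

codeLists-complete : ∀ r cs → All (_< r) cs → cs ∈ codeLists (fiberSizes cs r) (length cs)
codeLists-complete zero    []       _        = here refl
codeLists-complete zero    (x ∷ cs) (() ∷ _)
codeLists-complete (suc r) cs       bounded  =
  subst (_∈ codeLists (fiberSizes cs (suc r)) (length cs)) (interleave-split cs)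
    (∈-concatMap⁺′ (λ ms → map (interleave ms) (codeLists (fiberSizes (lower cs) r) (length cs ∸ count 0 cs)))
      zeros∈ (∈-map⁺ (interleave (map isZero cs))
        (subst (λ L → lower cs ∈ codeLists (fiberSizes (lower cs) r) L) (length-lower cs)
          (codeLists-complete r (lower cs) (lower-bounded r cs bounded)))))
  where
  zeros∈ : map isZero cs ∈ subsets (length cs) (count 0 cs)
  zeros∈ = subst₂ (λ a b → map isZero cs ∈ subsets a b) (length-map isZero cs) (trues-isZero cs)
             (subsets-complete (map isZero cs))

codeLists-unique : ∀ ks N → Unique (codeLists ks N)
codeLists-unique []       zero    = [] ∷ []
codeLists-unique []       (suc N) = []
codeLists-unique (k ∷ ks) N       =
  concatMap-unique (map isZero) (λ ms → map (interleave ms) (codeLists ks (N ∸ k))) (subsets N k)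
    (subsets-unique N k)
    (λ {ms} _ y∈ → let (rs , _ , e) = ∈-map⁻ (interleave ms) y∈ in
                   trans (cong (map isZero) e) (isZero-interleave ms rs))
    (λ {ms} ms∈ → map-unique (interleave ms) _ (codeLists-unique ks (N ∸ k)) λ {rs} {rs′} rs∈ rs′∈ e →
       let fits  = trans (subsets-falses N k ms ms∈) (sym (proj₁ (codeLists-sound ks _ rs rs∈)))
           fits′ = trans (subsets-falses N k ms ms∈) (sym (proj₁ (codeLists-sound ks _ rs′ rs′∈)))
       in trans (sym (lower-interleave ms rs fits)) (trans (cong lower e) (lower-interleave ms rs′ fits′)))

binomial-factorials : ∀ N k → k ≤ N → (N C k) * (k ! * (N ∸ k) !) ≡ N !
binomial-factorials N k k≤N = trans (cong (_* (k ! * (N ∸ k) !)) (nCk≡n!/k![n-k]! k≤N))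
  (m/n*n≡m {{k !* (N ∸ k) !≢0}} (k![n∸k]!∣n! k≤N))

length-codeLists : ∀ ks N → sum ks ≡ N → length (codeLists ks N) * product (map _! ks) ≡ N !
length-codeLists []       zero e    = refl
length-codeLists (k ∷ ks) N    refl = begin
  length (codeLists (k ∷ ks) N) * (k ! * P)
    ≡⟨ cong (_* (k ! * P)) (length-concatMap-const (λ ms → map (interleave ms) (codeLists ks (N ∸ k))) L
         (subsets N k) (λ {ms} _ → length-map (interleave ms) (codeLists ks (N ∸ k)))) ⟩
  length (subsets N k) * L * (k ! * P)
    ≡⟨ cong (λ z → z * L * (k ! * P)) (length-subsets N k) ⟩
  (N C k) * L * (k ! * P)
    ≡⟨ rearrange (N C k) L (k !) P ⟩
  (N C k) * (k ! * (L * P))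
    ≡⟨ cong (λ z → (N C k) * (k ! * z)) (length-codeLists ks (N ∸ k) (sym (m+n∸m≡n k (sum ks)))) ⟩
  (N C k) * (k ! * (N ∸ k) !)
    ≡⟨ binomial-factorials N k (m≤m+n k (sum ks)) ⟩
  N ! ∎
  where
  open ≡-Reasoning
  P = product (map _! ks)
  L = length (codeLists ks (N ∸ k))
  rearrange : ∀ a b c d → a * b * (c * d) ≡ a * (c * (b * d))
  rearrange a b c d = begin
    a * b * (c * d)   ≡⟨ *-assoc a b (c * d) ⟩
    a * (b * (c * d)) ≡⟨ cong (a *_) (*-assoc b c d) ⟨
    a * (b * c * d)   ≡⟨ cong (λ z → a * (z * d)) (*-comm b c) ⟩
    a * (c * b * d)   ≡⟨ cong (a *_) (*-assoc c b d) ⟩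
    a * (c * (b * d)) ∎

length-codeLists≡multinomial : ∀ ks N → sum ks ≡ N → length (codeLists ks N) ≡ multinomial N ks
length-codeLists≡multinomial ks N e = sym (trans
  (cong (λ z → (z / product (map _! ks)) {{prodFact-nonZero ks}}) (sym (length-codeLists ks N e)))
  (m*n/n≡m (length (codeLists ks N)) (product (map _! ks)) {{prodFact-nonZero ks}}))

≡ᵇ-true : ∀ {x l} → (x ≡ᵇ l) ≡ true → x ≡ l
≡ᵇ-true {x} {l} e = ≡ᵇ⇒≡ x l (true⇒T e)

≡ᵇ-false : ∀ {x l} → (x ≡ᵇ l) ≡ false → x ≢ l
≡ᵇ-false {x} {l} e refl = subst T e (≡⇒≡ᵇ x x refl)

count-lower : ∀ l cs → count l (lower cs) ≡ count (suc l) cs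
count-lower l []           = refl
count-lower l (zero ∷ cs)  = count-lower l cs
count-lower l (suc x ∷ cs) with x ≡ᵇ l
... | true  = cong suc (count-lower l cs)
... | false = count-lower l cs

nth-fiberSizes : ∀ r cs l → l < r → nth (fiberSizes cs r) l ≡ count l cs
nth-fiberSizes (suc r) cs zero    _        = refl
nth-fiberSizes (suc r) cs (suc l) (s≤s lt) = trans (nth-fiberSizes r (lower cs) l lt) (count-lower l cs)

length-fiberSizes : ∀ r cs → length (fiberSizes cs r) ≡ r
length-fiberSizes zero    cs = refl
length-fiberSizes (suc r) cs = cong suc (length-fiberSizes r (lower cs))

All-fiberSizes : ∀ (P : ℕ → Set) r cs → (∀ l → l < r → P (count l cs)) → All P (fiberSizes cs r)
All-fiberSizes P zero    cs h = []
All-fiberSizes P (suc r) cs h = h 0 (s≤s z≤n) ∷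
  All-fiberSizes P r (lower cs) (λ l lt → subst P (sym (count-lower l cs)) (h (suc l) (s≤s lt)))

sum-fiberSizes : ∀ r cs → All (_< r) cs → sum (fiberSizes cs r) ≡ length cs
sum-fiberSizes zero    []       _        = refl
sum-fiberSizes zero    (x ∷ cs) (() ∷ _)
sum-fiberSizes (suc r) cs       bounded  =
  trans (cong (count 0 cs +_) (trans (sum-fiberSizes r (lower cs) (lower-bounded r cs bounded)) (length-lower cs)))
        (m+[n∸m]≡n (count≤length 0 cs))

count-positive : ∀ l cs → 1 ≤ count l cs → ∃ λ j → j < length cs × nth cs j ≡ l
count-positive l (x ∷ cs) le with x ≡ᵇ l in e
... | true  = 0 , s≤s z≤n , ≡ᵇ-true e
... | false = let (j , lt , eq) = count-positive l cs le in suc j , s≤s lt , eq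

count-two : ∀ l cs → 2 ≤ count l cs →
  ∃ λ j → ∃ λ j′ → j ≢ j′ × j < length cs × j′ < length cs × nth cs j ≡ l × nth cs j′ ≡ l
count-two l (x ∷ cs) le with x ≡ᵇ l in e
... | true  = let (j , lt , eq) = count-positive l cs (≤-pred le) in
  0 , suc j , (λ ()) , s≤s z≤n , s≤s lt , ≡ᵇ-true e , eq
... | false = let (j , j′ , j≢j′ , lt , lt′ , eq , eq′) = count-two l cs le in
  suc j , suc j′ , (j≢j′ ∘ suc-injective) , s≤s lt , s≤s lt′ , eq , eq′

count-hit : ∀ l x cs → x ≡ l → count l (x ∷ cs) ≡ suc (count l cs)
count-hit l x cs e with x ≡ᵇ l in e′
... | true  = refl
... | false = ⊥-elim (≡ᵇ-false e′ e)

count-tabulate-1 : ∀ {n} (code : Fin n → ℕ) i l → code i ≡ l → 1 ≤ count l (tabulate code)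
count-tabulate-1 code zero    l e = subst (1 ≤_) (sym (count-hit l (code zero) (tabulate (code ∘ suc)) e)) (s≤s z≤n)
count-tabulate-1 code (suc i) l e with code zero ≡ᵇ l
... | true  = s≤s z≤n
... | false = count-tabulate-1 (code ∘ suc) i l e

count-tabulate-2 : ∀ {n} (code : Fin n → ℕ) i i′ l → i ≢ i′ → code i ≡ l → code i′ ≡ l →
  2 ≤ count l (tabulate code)
count-tabulate-2 code zero    zero     l i≢i′ e e′ = ⊥-elim (i≢i′ refl)
count-tabulate-2 code zero    (suc i′) l i≢i′ e e′ =
  subst (2 ≤_) (sym (count-hit l (code zero) (tabulate (code ∘ suc)) e)) (s≤s (count-tabulate-1 (code ∘ suc) i′ l e′))
count-tabulate-2 code (suc i) zero     l i≢i′ e e′ =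
  subst (2 ≤_) (sym (count-hit l (code zero) (tabulate (code ∘ suc)) e′)) (s≤s (count-tabulate-1 (code ∘ suc) i l e))
count-tabulate-2 code (suc i) (suc i′) l i≢i′ e e′ with code zero ≡ᵇ l
... | true  = m≤n⇒m≤1+n (count-tabulate-2 (code ∘ suc) i i′ l (i≢i′ ∘ cong suc) e e′)
... | false = count-tabulate-2 (code ∘ suc) i i′ l (i≢i′ ∘ cong suc) e e′

All-tabulate : ∀ {n} {P : ℕ → Set} (code : Fin n → ℕ) → (∀ i → P (code i)) → All P (tabulate code)
All-tabulate {zero}  code h = []
All-tabulate {suc n} code h = h zero ∷ All-tabulate (code ∘ suc) (h ∘ suc)

tuples-complete : ∀ n ks → All (λ k → 1 ≤ k × k ≤ n) ks → ks ∈ tuples (length ks) n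
tuples-complete n []           _                    = here refl
tuples-complete n (suc k ∷ ks) ((s≤s _ , k≤n) ∷ bs) =
  ∈-concatMap⁺′ (λ k → map (k ∷_) (tuples (length ks) n)) (∈-map⁺ suc (∈-upTo⁺ k≤n))
    (∈-map⁺ (suc k ∷_) (tuples-complete n ks bs))

tuples-sound : ∀ r n ks → ks ∈ tuples r n → length ks ≡ r × All (1 ≤_) ks
tuples-sound zero    n .[] (here refl) = refl , []
tuples-sound (suc r) n ks  p with ∈-concatMap⁻′ (λ k → map (k ∷_) (tuples r n)) {xs = map suc (upTo n)} p
... | k , k∈ , q with ∈-map⁻ (k ∷_) q | ∈-map⁻ suc k∈
...   | ks′ , ks′∈ , refl | _ , _ , refl =
  let (len , pos) = tuples-sound r n ks′ ks′∈ in cong suc len , s≤s z≤n ∷ pos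

tuples-unique : ∀ r n → Unique (tuples r n)
tuples-unique zero    n = [] ∷ []
tuples-unique (suc r) n =
  concatMap-unique (λ ks → nth ks 0) (λ k → map (k ∷_) (tuples r n)) (map suc (upTo n))
    (map-unique suc (upTo n) (upTo⁺ n) (λ _ _ → suc-injective))
    (λ {k} _ y∈ → let (_ , _ , e) = ∈-map⁻ (k ∷_) y∈ in cong (λ w → nth w 0) e)
    (λ {k} _ → map-unique (k ∷_) (tuples r n) (tuples-unique r n) (λ _ _ → ∷-injectiveʳ))

length≤sum : ∀ ks → All (1 ≤_) ks → length ks ≤ sum ks
length≤sum []       _        = z≤n
length≤sum (k ∷ ks) (p ∷ ps) = +-mono-≤ p (length≤sum ks ps)

lastAtLeast2⇒ : ∀ xs → lastAtLeast2 xs ≡ true → 2 ≤ nth xs (pred (length xs))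
lastAtLeast2⇒ (k ∷ [])     e = ≤ᵇ⇒≤ 2 k (true⇒T e)
lastAtLeast2⇒ (x ∷ k ∷ ks) e = lastAtLeast2⇒ (k ∷ ks) e

⇒lastAtLeast2 : ∀ xs → 1 ≤ length xs → 2 ≤ nth xs (pred (length xs)) → lastAtLeast2 xs ≡ true
⇒lastAtLeast2 (k ∷ [])     _ le = T⇒true (≤⇒≤ᵇ le)
⇒lastAtLeast2 (x ∷ k ∷ ks) _ le = ⇒lastAtLeast2 (k ∷ ks) (s≤s z≤n) le

-- The parameters of a monotone NCF: its direction, the value of layer 0,
-- the layer sizes and the code list.
record Param : Set where
  constructor param
  field
    increasing : Bool
    start      : Bool
    sizes      : List ℕ
    codes      : List ℕ

codeOf : ∀ {n} → List ℕ → Fin n → ℕ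
codeOf cs i = nth cs (toℕ i)

function : ∀ {n} → Param → BF n
function (param true  c ks cs) = layered c (length ks) (codeOf cs)
function (param false c ks cs) = layered c (length ks) (codeOf cs) ∘ (not ∘_)

variants : List ℕ → List ℕ → List Param
variants ks cs = param true true ks cs ∷ param true false ks cs ∷ param false true ks cs ∷ param false false ks cs ∷ []

admissibleTuples : ℕ → ℕ → List (List ℕ)
admissibleTuples n r = filterᵇ (admissible n) (tuples r n)

paramsFor : ℕ → List ℕ → List Param
paramsFor n ks = concatMap (variants ks) (codeLists ks n)

paramsOfLength : ℕ → ℕ → List Param
paramsOfLength n r = concatMap (paramsFor n) (admissibleTuples n r)

-- all parameters for n variables; the list is indexed like compositionSum
params : ℕ → List Param
params n = concatMap (paramsOfLength n) (map suc (upTo n))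

Valid : ℕ → List ℕ → List ℕ → Set
Valid n ks cs = Canonical {n} (codeOf cs) (length ks) × length cs ≡ n × fiberSizes cs (length ks) ≡ ks

variants-shape : ∀ ks cs {p} → p ∈ variants ks cs → Param.sizes p ≡ ks × Param.codes p ≡ cs
variants-shape ks cs (here refl)                         = refl , refl
variants-shape ks cs (there (here refl))                 = refl , refl
variants-shape ks cs (there (there (here refl)))         = refl , refl
variants-shape ks cs (there (there (there (here refl)))) = refl , refl

variants-unique : ∀ ks cs → Unique (variants ks cs)
variants-unique ks cs = ((λ ()) ∷ (λ ()) ∷ (λ ()) ∷ []) ∷ ((λ ()) ∷ (λ ()) ∷ []) ∷ ((λ ()) ∷ []) ∷ [] ∷ []

admissible-sound : ∀ n r ks → ks ∈ admissibleTuples n r →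
  length ks ≡ r × All (1 ≤_) ks × sum ks ≡ n × lastAtLeast2 ks ≡ true
admissible-sound n r ks ks∈ =
  let (ks∈tuples , adm) = ∈-filter⁻ (T? ∘ admissible n) {xs = tuples r n} ks∈
      (len , pos) = tuples-sound r n ks ks∈tuples
      (sum≡ , last2) = Equivalence.to T-∧ adm
  in len , pos , ≡ᵇ⇒≡ (sum ks) n sum≡ , T⇒true last2

params-member : ∀ n {p} → p ∈ params n → ∃ λ r → ∃ λ ks → ∃ λ cs →
  ks ∈ admissibleTuples n r × cs ∈ codeLists ks n × Param.sizes p ≡ ks × Param.codes p ≡ cs
params-member n p∈ =
  let (r , _ , q₁)   = ∈-concatMap⁻′ (paramsOfLength n) {xs = map suc (upTo n)} p∈
      (ks , ks∈ , q₂) = ∈-concatMap⁻′ (paramsFor n) {xs = admissibleTuples n r} q₁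
      (cs , cs∈ , q₃) = ∈-concatMap⁻′ (variants ks) {xs = codeLists ks n} q₂
      (sizes≡ , codes≡) = variants-shape ks cs q₃
  in r , ks , cs , ks∈ , cs∈ , sizes≡ , codes≡

admissible-canonical : ∀ n ks cs → All (1 ≤_) ks → lastAtLeast2 ks ≡ true →
  length cs ≡ n → All (_< length ks) cs → fiberSizes cs (length ks) ≡ ks →
  Canonical {n} (codeOf cs) (length ks)
admissible-canonical n ks cs pos last2 len bounded fibers = below-R , onto , top-not-singleton
  where
  R = length ks
  position : ∀ j → j < length cs → Fin n
  position j lt = fromℕ< (subst (j <_) len lt)
  code-position : ∀ j lt → codeOf cs (position j lt) ≡ nth cs j
  code-position j lt = cong (nth cs) (toℕ-fromℕ< _)
  size-count : ∀ l → l < R → nth ks l ≡ count l cs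
  size-count l lt = trans (cong (λ z → nth z l) (sym fibers)) (nth-fiberSizes R cs l lt)
  below-R : ∀ i → codeOf cs i < R
  below-R i = All-nth bounded (toℕ i) (subst (toℕ i <_) (sym len) (toℕ<n i))
  onto : ∀ l → l < R → ∃ λ i → codeOf cs i ≡ l
  onto l lt = let (j , jl , e) = count-positive l cs (subst (1 ≤_) (size-count l lt) (All-nth pos l lt)) in
    position j jl , trans (code-position j jl) e
  top-not-singleton : ∀ i → ¬ (∀ k → codeOf cs k ≡ pred R → k ≡ i)
  top-not-singleton i only =
    let R>0 = ≤-<-trans z≤n (below-R i)
        top = ∸-monoʳ-< {R} {1} {0} (s≤s z≤n) R>0
        (j , j′ , j≢j′ , jl , j′l , e , e′) =
          count-two (pred R) cs (subst (2 ≤_) (size-count (pred R) top) (lastAtLeast2⇒ ks last2))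
        same = trans (only (position j jl) (trans (code-position j jl) e))
                     (sym (only (position j′ j′l) (trans (code-position j′ j′l) e′)))
    in j≢j′ (trans (sym (toℕ-fromℕ< _)) (trans (cong toℕ same) (toℕ-fromℕ< _)))

params-valid : ∀ n {p} → p ∈ params n → Valid n (Param.sizes p) (Param.codes p)
params-valid n {param d c ks₀ cs₀} p∈ with params-member n p∈
... | r , ks , cs , ks∈ , cs∈ , refl , refl =
  let (_ , pos , _ , last2) = admissible-sound n r ks ks∈
      (len , bounded , fibers) = codeLists-sound ks n cs cs∈
  in admissible-canonical n ks cs pos last2 len bounded fibers , len , fibers

layered-constant : ∀ {n} c R (code : Fin n → ℕ) → Canonical code R → Fin n → ∀ b →
  layered c R code (λ _ → b) ≡ b
layered-constant c R code (below-R , onto , _) i₀ b with bool-cases c b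
... | inj₁ c≡b = trans (layered-value c R code _ 0 z≤n (λ _ ())
                         (let (i , ci) = onto 0 R>0 in inj₂ (i , ci , sym c≡b))) c≡b
  where
  R>0 = ≤-<-trans z≤n (below-R i₀)
... | inj₂ c≡¬b = trans (layered-value c R code _ 1 R>0 layer0-misses layer1-hit)
                        (trans (cong not c≡¬b) (not-involutive b))
  where
  R>0 = ≤-<-trans z≤n (below-R i₀)
  b≡alt1 : b ≡ alt c 1
  b≡alt1 = sym (trans (cong not c≡¬b) (not-involutive b))
  layer0-misses : ∀ i → code i < 1 → b ≡ not (alt c (code i))
  layer0-misses i lt = trans b≡alt1 (cong (not ∘ alt c) (sym (n<1⇒n≡0 lt)))
  layer1-hit : 1 ≡ R ⊎ ∃ λ i → code i ≡ 1 × b ≡ alt c 1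
  layer1-hit with 1 <? R
  ... | no  1≮R = inj₁ (≤-antisym R>0 (≮⇒≥ 1≮R))
  ... | yes 1<R = let (i , ci) = onto 1 1<R in inj₂ (i , ci , b≡alt1)

layered-params-injective : ∀ n c ks cs c′ ks′ cs′ → Valid (suc n) ks cs → Valid (suc n) ks′ cs′ →
  (∀ x → layered c (length ks) (codeOf cs) x ≡ layered c′ (length ks′) (codeOf cs′) x) →
  c ≡ c′ × ks ≡ ks′ × cs ≡ cs′
layered-params-injective n c ks cs c′ ks′ cs′ (canon , len , fibers) (canon′ , len′ , fibers′) same =
  let (c≡c′ , codes≡ , R≡) = layered-injective c _ (codeOf cs) c′ _ (codeOf cs′) canon canon′ zero same
      cs≡cs′ = nth-ext cs cs′ (trans len (sym len′)) λ j lt →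
        let i = fromℕ< (subst (j <_) len lt) in
        trans (cong (nth cs) (sym (toℕ-fromℕ< _))) (trans (codes≡ i) (cong (nth cs′) (toℕ-fromℕ< _)))
  in c≡c′ , trans (sym fibers) (trans (cong₂ fiberSizes cs≡cs′ R≡) fibers′) , cs≡cs′

-- Distinct valid parameters give distinct functions; increasing and
-- decreasing ones are told apart by the constant input false.
function-injective : ∀ n (p q : Param) → Valid (suc n) (Param.sizes p) (Param.codes p) →
  Valid (suc n) (Param.sizes q) (Param.codes q) → function {suc n} p ≐ function q → p ≡ q
function-injective n (param true c ks cs) (param true c′ ks′ cs′) vp vq same
  with layered-params-injective n c ks cs c′ ks′ cs′ vp vq same
... | refl , refl , refl = refl
function-injective n (param false c ks cs) (param false c′ ks′ cs′) vp vq same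
  with layered-params-injective n c ks cs c′ ks′ cs′ vp vq (λ x →
    trans (layered-ext c _ (codeOf cs) x _ (sym ∘ not-involutive ∘ x))
          (trans (same (not ∘ x)) (layered-ext c′ _ (codeOf cs′) _ x (not-involutive ∘ x))))
... | refl , refl , refl = refl
function-injective n (param true c ks cs) (param false c′ ks′ cs′) vp vq same = ⊥-elim (false≢true
  (trans (sym (layered-constant c _ (codeOf cs) (proj₁ vp) zero false))
         (trans (same (λ _ → false)) (layered-constant c′ _ (codeOf cs′) (proj₁ vq) zero true))))
  where
  false≢true : false ≢ true
  false≢true ()
function-injective n (param false c ks cs) (param true c′ ks′ cs′) vp vq same = ⊥-elim (false≢true
  (trans (sym (layered-constant c′ _ (codeOf cs′) (proj₁ vq) zero false))
         (trans (sym (same (λ _ → false))) (layered-constant c _ (codeOf cs) (proj₁ vp) zero true))))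
  where
  false≢true : false ≢ true
  false≢true ()

canonical-sizes : ∀ {m} (code : Fin (suc m) → ℕ) R → Canonical code R →
  fiberSizes (tabulate code) R ∈ admissibleTuples (suc m) R × R ∈ map suc (upTo (suc m))
canonical-sizes {m} code R (below-R , onto , top-not-singleton) = ks∈ , R∈
  where
  n = suc m
  cs = tabulate code
  ks = fiberSizes cs R
  len : length cs ≡ n
  len = length-tabulate code
  sum≡n : sum ks ≡ n
  sum≡n = trans (sum-fiberSizes R cs (All-tabulate code below-R)) len
  entries : All (λ k → 1 ≤ k × k ≤ n) ks
  entries = All-fiberSizes _ R cs λ l lt → let (i , ci) = onto l lt in
    count-tabulate-1 code i l ci , subst (count l cs ≤_) len (count≤length l cs)
  R>0 : 0 < R
  R>0 = ≤-<-trans z≤n (below-R zero)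
  top : pred R < R
  top = ∸-monoʳ-< {R} {1} {0} (s≤s z≤n) R>0
  top-two : 2 ≤ count (pred R) cs
  top-two with onto (pred R) top
  ... | i , ci with alone-or-not code i (pred R)
  ...   | inj₁ (k , k≢i , ck) = count-tabulate-2 code i k (pred R) (k≢i ∘ sym) ci ck
  ...   | inj₂ alone          = ⊥-elim (top-not-singleton i alone)
  last2 : lastAtLeast2 ks ≡ true
  last2 = ⇒lastAtLeast2 ks (subst (1 ≤_) (sym (length-fiberSizes R cs)) R>0)
            (subst (λ z → 2 ≤ nth ks z) (cong pred (sym (length-fiberSizes R cs)))
              (subst (2 ≤_) (sym (nth-fiberSizes R cs (pred R) top)) top-two))
  ks∈ : ks ∈ admissibleTuples n R
  ks∈ = ∈-filter⁺ (T? ∘ admissible n)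
          (subst (λ r → ks ∈ tuples r n) (length-fiberSizes R cs) (tuples-complete n ks entries))
          (Equivalence.from T-∧ (≡⇒≡ᵇ (sum ks) n sum≡n , true⇒T last2))
  R≤n : R ≤ n
  R≤n = subst₂ _≤_ (length-fiberSizes R cs) sum≡n (length≤sum ks (All.map proj₁ entries))
  R∈ : R ∈ map suc (upTo n)
  R∈ = subst (_∈ map suc (upTo n)) (suc-pred R {{>-nonZero R>0}}) (∈-map⁺ suc (∈-upTo⁺ (<-≤-trans top R≤n)))

canonical-params : ∀ {m} (code : Fin (suc m) → ℕ) R → Canonical code R → ∀ d c →
  ∃ λ ks → ∃ λ cs → param d c ks cs ∈ params (suc m) × length ks ≡ R × (∀ i → codeOf cs i ≡ code i)
canonical-params {m} code R canon d c =
  ks , cs , member , length-fiberSizes R cs , nth-tabulate code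
  where
  cs = tabulate code
  ks = fiberSizes cs R
  cs∈ : cs ∈ codeLists ks (suc m)
  cs∈ = subst (λ L → cs ∈ codeLists ks L) (length-tabulate code)
          (codeLists-complete R cs (All-tabulate code (proj₁ canon)))
  variant∈ : ∀ d c → param d c ks cs ∈ variants ks cs
  variant∈ true  true  = here refl
  variant∈ true  false = there (here refl)
  variant∈ false true  = there (there (here refl))
  variant∈ false false = there (there (there (here refl)))
  member : param d c ks cs ∈ params (suc m)
  member = let (ks∈ , R∈) = canonical-sizes code R canon in
    ∈-concatMap⁺′ (paramsOfLength (suc m)) R∈ (∈-concatMap⁺′ (paramsFor (suc m)) ks∈
      (∈-concatMap⁺′ (variants ks) cs∈ (variant∈ d c)))

-- The parameter list has no repetitions: each parameter records its
-- number of layers, its sizes and its codes.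
params-unique : ∀ n → Unique (params n)
params-unique n =
  concatMap-unique (length ∘ Param.sizes) (paramsOfLength n) (map suc (upTo n))
    (map-unique suc (upTo n) (upTo⁺ n) (λ _ _ → suc-injective))
    layers-keyed
    (λ {r} _ → concatMap-unique Param.sizes (paramsFor n) (admissibleTuples n r)
       (AllPairsP.filter⁺ (T? ∘ admissible n) (tuples-unique r n))
       (sizes-keyed {r})
       (λ {ks} _ → concatMap-unique Param.codes (variants ks) (codeLists ks n) (codeLists-unique ks n)
          (λ {cs} _ y∈ → proj₂ (variants-shape ks cs y∈))
          (λ {cs} _ → variants-unique ks cs)))
  where
  sizes-keyed : ∀ {r ks y} → ks ∈ admissibleTuples n r → y ∈ paramsFor n ks → Param.sizes y ≡ ks
  sizes-keyed {ks = ks} _ y∈ = let (cs , _ , q) = ∈-concatMap⁻′ (variants ks) {xs = codeLists ks n} y∈ in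
    proj₁ (variants-shape ks cs q)
  layers-keyed : ∀ {r y} → r ∈ map suc (upTo n) → y ∈ paramsOfLength n r → length (Param.sizes y) ≡ r
  layers-keyed {r} _ y∈ =
    let (ks , ks∈ , q) = ∈-concatMap⁻′ (paramsFor n) {xs = admissibleTuples n r} y∈ in
    trans (cong length (sizes-keyed {r = r} ks∈ q)) (proj₁ (admissible-sound n r ks ks∈))

-- Four parameters per code list, and multinomially many code lists per
-- admissible tuple.
params-length : ∀ n → length (params n) ≡ 4 * compositionSum n
params-length n = trans
  (length-concatMap (paramsOfLength n) (λ r → sum (map (multinomial n) (admissibleTuples n r))) 4
     (map suc (upTo n)) λ {r} _ →
     length-concatMap (paramsFor n) (multinomial n) 4 (admissibleTuples n r) λ {ks} ks∈ →
       trans (length-concatMap-const (variants ks) 4 (codeLists ks n) (λ _ → refl))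
         (trans (*-comm (length (codeLists ks n)) 4)
           (cong (4 *_) (length-codeLists≡multinomial ks n (proj₁ (proj₂ (proj₂ (admissible-sound n r ks ks∈))))))))
  (cong (4 *_) (sym (sum-concatMap (λ r → map (multinomial n) (admissibleTuples n r)) (map suc (upTo n)))))

params-monotone-NCF : ∀ m (p : Param) → Valid (suc m) (Param.sizes p) (Param.codes p) →
  Monotone (function {suc m} p) × NestedCanalyzing (function {suc m} p)
params-monotone-NCF m (param true c ks cs) (canon , _) =
  inj₁ (layered-increasing c (length ks) (codeOf cs)) , (σ , values , values , nestedCanalyzing)
  where open LayeredNCF c (length ks) (codeOf cs) canon
params-monotone-NCF m (param false c ks cs) (canon , _) =
  inj₂ (negate-increasing (layered c (length ks) (codeOf cs)) (layered-increasing c (length ks) (codeOf cs))) ,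
  (σ , not ∘ values , values , negate-nestedCanalyzing (layered c (length ks) (codeOf cs)) σ values values nestedCanalyzing)
  where open LayeredNCF c (length ks) (codeOf cs) canon

params-complete : ∀ m (f : BF (suc (suc m))) → Monotone f → NestedCanalyzing f →
  ∃ λ p → p ∈ params (suc (suc m)) × f ≐ function p
params-complete m f (inj₁ inc) nc =
  let (c , R , code , canon , represents) = increasing-layered f inc nc
      (ks , cs , member , len , codes) = canonical-params code R canon true c
  in param true c ks cs , member , λ x →
       trans (represents x) (trans (cong (λ r → layered c r code x) (sym len))
                                   (sym (layered-cong c (length ks) (codeOf cs) code x codes)))
params-complete m f (inj₂ dec) nc =
  let (c , R , code , canon , represents) = decreasing-layered f dec nc
      (ks , cs , member , len , codes) = canonical-params code R canon false c
  in param false c ks cs , member , λ x →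
       trans (represents x) (trans (cong (λ r → layered c r code (not ∘ x)) (sym len))
                                   (sym (layered-cong c (length ks) (codeOf cs) code (not ∘ x) codes)))

corollary4p1 : (m : ℕ) → 1 ≤ m →
    Σ (List (BF (suc m))) λ L →
      All (λ f → Monotone f × NestedCanalyzing f) L
      × AllPairs (λ f g → ¬ (f ≐ g)) L
      × (∀ (f : BF (suc m)) → Monotone f → NestedCanalyzing f → ∃ λ g → g ∈ L × f ≐ g)
      × length L ≡ 4 * compositionSum (suc m)
corollary4p1 (suc m) _ =
  map function ps ,
  AllP.map⁺ (All.tabulate λ {p} p∈ → params-monotone-NCF (suc m) p (params-valid n p∈)) ,
  AllPairsP.map⁺ (unique⇒AllPairs (λ p q → function p ≐ function q) ps (params-unique n)
    λ {p} {q} p∈ q∈ → function-injective (suc m) p q (params-valid n p∈) (params-valid n q∈)) ,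
  (λ f mono nc → let (p , p∈ , f≐p) = params-complete m f mono nc in function p , ∈-map⁺ function p∈ , f≐p) ,
  trans (length-map function ps) (params-length n)
  where
  n = suc (suc m)
  ps = params n
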